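{- $\mathsf{HS}_{\mathsf{lin}}$ and $\mathsf{HS}_{\mathsf{st}}$ are expressively incomparable, and so are $\mathsf{HS}_{\mathsf{lin}}$ and $\mathsf{HS}_{\mathsf{ct}}$.
   Context: A Kripke structure is $K=(\mathcal{AP},S,\delta,\mu,s_0)$ ($\mathcal{AP}$ finite, left-total $\delta\subseteq S\times S$, $\mu:S\to2^{\mathcal{AP}}$, initial $s_0$); finite if $S$ finite. Infinite paths and traces (non-empty finite paths) follow $\delta$, initial if they start at $s_0$; $\mathrm{lst}(\rho)$ is the last state of a trace. $\mathsf{HS}$: $\psi::=p\mid\neg\psi\mid\psi\wedge\psi\mid\langle B\rangle\psi\mid\langle E\rangle\psi\mid\langle\overline{B}\rangle\psi\mid\langle\overline{E}\rangle\psi$ (other Halpern–Shoham modalities are abbreviations). State-based ($\mathsf{HS}_{\mathsf{st}}$): on traces, $\rho\models p$ iff $p$ labels every state of $\rho$; $\langle B\rangle$/$\langle E\rangle$: some proper non-empty prefix/suffix satisfies the argument; $\langle\overline{B}\rangle$/$\langle\overline{E}\rangle$: some trace having $\rho$ as proper prefix/suffix satisfies it; $K\models_{\mathsf{st}}\psi$ iff all initial traces satisfy $\psi$. Computation-tree-based ($\mathsf{HS}_{\mathsf{ct}}$): $C(K)$ has states the initial traces of $K$, transitions $(\rho,\rho s)$ for $(\mathrm{lst}(\rho),s)\in\delta$, labels $\mu(\mathrm{lst}(\rho))$, initial state $s_0$; $K\models_{\mathsf{ct}}\psi$ iff $C(K)\models_{\mathsf{st}}\psi$. Trace-based ($\mathsf{HS}_{\mathsf{lin}}$):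 an infinite path $\pi$ induces intervals $[i,j]$ ($i\le j$) labelled $\bigcap_{h=i}^j\mu(\pi(h))$; $\langle B\rangle$: some $[i,j']$, $i\le j'<j$; $\langle E\rangle$: some $[i',j]$, $i<i'\le j$; $\langle\overline{B}\rangle$: some $[i,j']$, $j'>j$; $\langle\overline{E}\rangle$: some $[i',j]$, $i'<i$; $K\models_{\mathsf{lin}}\psi$ iff for every initial infinite path and every $i\ge0$, $[0,i]\models\psi$. Two logics $L_1,L_2$ (each with a notion of a finite Kripke structure being a model of a formula) are expressively incomparable if neither $L_1\geq L_2$ nor $L_2\geq L_1$, where $L_1\geq L_2$ means every $L_2$ formula has an $L_1$ formula with exactly the same finite Kripke structures as models. -}

module Defs where

open import Data.Nat using (ℕ; suc; _≤_; _<_)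
open import Data.Fin using (Fin)
open import Data.Bool using (Bool; true; T)
open import Data.List using (List; []; _∷_)
open import Data.List.NonEmpty using (List⁺; _∷_; toList; last; _⁺++_; _++⁺_; _⁺∷ʳ_; [_])
open import Data.List.Relation.Unary.All using (All)
open import Data.Product using (Σ; _×_; _,_; proj₁; ∃)
open import Relation.Binary.PropositionalEquality using (_≡_; _≢_)
open import Relation.Nullary using (¬_)
open import Function.Bundles using (_⇔_)

data HS (AP : Set) : Set where
  atom  : AP → HS AP
  ¬'_   : HS AP → HS AP
  _∧'_  : HS AP → HS AP → HS AP
  ⟨B⟩   : HS AP → HS AP
  ⟨E⟩   : HS AP → HS AP
  ⟨B̄⟩   : HS AP → HS AP
  ⟨Ē⟩   : HS AP → HS AP

-- General (possibly infinite) Kripke structures.  Left-totality is not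
-- needed to define the semantics, so it is only required of finite
-- structures (FinKripke) below; C(K) is left-total anyway.

record Kripke (AP : Set) : Set₁ where
  field
    S  : Set
    δ  : S → S → Set
    μ  : S → AP → Bool
    s₀ : S

record FinKripke (AP : Set) : Set where
  field
    m     : ℕ
    δ     : Fin m → Fin m → Bool
    total : ∀ s → Σ (Fin m) λ t → T (δ s t)
    μ     : Fin m → AP → Bool
    s₀    : Fin m

toKripke : ∀ {AP} → FinKripke AP → Kripke AP
toKripke K = record { S = Fin m ; δ = λ s t → T (δ s t) ; μ = μ ; s₀ = s₀ }
  where open FinKripke K

module _ {AP : Set} (K : Kripke AP) where
  open Kripke K

  data IsPath : List S → Set where
    []   : IsPath []
    single : ∀ s → IsPath (s ∷ [])
    step : ∀ {s t rest} → δ s t → IsPath (t ∷ rest) → IsPath (s ∷ t ∷ rest)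

  IsTrace : List⁺ S → Set
  IsTrace ρ = IsPath (toList ρ)

  IsInitTrace : List⁺ S → Set
  IsInitTrace ρ = IsTrace ρ × Data.List.NonEmpty.head ρ ≡ s₀

  satSt : HS AP → List⁺ S → Set
  satSt (atom p) ρ  = All (λ s → μ s p ≡ true) (toList ρ)
  satSt (¬' ψ) ρ    = ¬ satSt ψ ρ
  satSt (ψ ∧' φ) ρ  = satSt ψ ρ × satSt φ ρ
  satSt (⟨B⟩ ψ) ρ   = Σ (List⁺ S) λ ρ' → Σ (List S) λ σ →
                        σ ≢ [] × ρ ≡ ρ' ⁺++ σ × satSt ψ ρ'
  satSt (⟨E⟩ ψ) ρ   = Σ (List S) λ σ → Σ (List⁺ S) λ ρ' →
                        σ ≢ [] × ρ ≡ σ ++⁺ ρ' × satSt ψ ρ'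
  satSt (⟨B̄⟩ ψ) ρ  = Σ (List S) λ σ →
                        σ ≢ [] × IsTrace (ρ ⁺++ σ) × satSt ψ (ρ ⁺++ σ)
  satSt (⟨Ē⟩ ψ) ρ  = Σ (List S) λ σ →
                        σ ≢ [] × IsTrace (σ ++⁺ ρ) × satSt ψ (σ ++⁺ ρ)

  _⊨st_ : HS AP → Set
  _⊨st_ ψ = ∀ ρ → IsInitTrace ρ → satSt ψ ρ

  CompTree : Kripke AP
  CompTree = record
    { S  = Σ (List⁺ S) IsInitTrace
    ; δ  = λ ρ ρ' → Σ S λ s → δ (last (proj₁ ρ)) s × proj₁ ρ' ≡ proj₁ ρ ⁺∷ʳ s
    ; μ  = λ ρ → μ (last (proj₁ ρ))
    ; s₀ = [ s₀ ] , (single s₀ , _≡_.refl)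
    }

  IsInfPath : (ℕ → S) → Set
  IsInfPath π = ∀ i → δ (π i) (π (suc i))

  satLin : (ℕ → S) → HS AP → ℕ → ℕ → Set
  satLin π (atom p) i j = ∀ h → i ≤ h → h ≤ j → μ (π h) p ≡ true
  satLin π (¬' ψ) i j   = ¬ satLin π ψ i j
  satLin π (ψ ∧' φ) i j = satLin π ψ i j × satLin π φ i j
  satLin π (⟨B⟩ ψ) i j  = Σ ℕ λ j' → i ≤ j' × j' < j × satLin π ψ i j'
  satLin π (⟨E⟩ ψ) i j  = Σ ℕ λ i' → i < i' × i' ≤ j × satLin π ψ i' j
  satLin π (⟨B̄⟩ ψ) i j = Σ ℕ λ j' → j < j' × satLin π ψ i j'
  satLin π (⟨Ē⟩ ψ) i j = Σ ℕ λ i' → i' < i × satLin π ψ i' j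

  _⊨lin_ : HS AP → Set
  _⊨lin_ ψ = ∀ π → IsInfPath π → π 0 ≡ s₀ → ∀ i → satLin π ψ 0 i

Semantics : Set → Set₁
Semantics AP = FinKripke AP → HS AP → Set

⊨St ⊨Ct ⊨Lin : ∀ {AP} → Semantics AP
⊨St  K ψ = toKripke K ⊨st ψ
⊨Ct  K ψ = CompTree (toKripke K) ⊨st ψ
⊨Lin K ψ = toKripke K ⊨lin ψ

_≽_ : ∀ {AP} → Semantics AP → Semantics AP → Set
L₁ ≽ L₂ = ∀ ψ → Σ (HS _) λ φ → ∀ K → (L₁ K φ ⇔ L₂ K ψ)

Incomparable : ∀ {AP} → Semantics AP → Semantics AP → Set
Incomparable L₁ L₂ = ¬ (L₁ ≽ L₂) × ¬ (L₂ ≽ L₁)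

module Submission where

-- The formula ¬⟨B̄⟩(p ∧ ¬⟨B̄⟩p), "no p-labelled trace is stuck in p", holds under the
-- state-based and the computation-tree semantics in a structure where every p-state has a
-- p-successor, and fails in one with a p-state whose successors are all ¬p. The second
-- structure maps homomorphically onto the first and linear validity is reflected along such
-- maps, so no HS_lin formula has the same models.
--
-- Conversely, ⟨B̄⟩¬p says linearly that every path eventually leaves p. On the ladder with
-- states 0, …, L + 1 that step down by one, loop at 0 and at L + 1, and satisfy p when
-- positive, this holds from the root L and fails from the root L + 1. A formula of depth d
-- cannot separate the two roots once L > 2 · 2 ^ d: traces (for C(K): pairs of history and
-- trace) that differ only in prefixes of states above t, of lengths that agree up to t, form
-- a back-and-forth system in which every modal move costs half of the threshold.

open import Defs
open import Data.Nat using (ℕ; zero; suc; _+_; _∸_; _^_; _⊓_; _⊔_; _≤_; _<_; z≤n; s≤s)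
open import Data.Nat using (_≟_; _<?_; _≤?_)
open import Data.Nat.Properties
open import Data.Fin using (Fin; zero; suc; toℕ; fromℕ; fromℕ<; inject₁)
open import Data.Fin.Properties using (toℕ-injective; toℕ<n; toℕ-fromℕ; toℕ-fromℕ<; toℕ-inject₁)
open import Data.Bool using (Bool; true; false; T)
open import Data.Unit using (tt)
open import Data.Empty using (⊥-elim)
open import Data.Sum using (_⊎_; inj₁; inj₂)
open import Data.Product using (∃-syntax; ∃₂; _×_; _,_; proj₁; proj₂)
open import Data.List using (List; []; _∷_; _++_; _∷ʳ_; length; map; initLast; _∷ʳ′_)
open import Data.List.Properties using (∷-injective; ∷-injectiveˡ; ∷ʳ-injective; length-++; map-++)
open import Data.List.Properties using (++-assoc; ++-identityʳ)
import Data.List.NonEmpty as List⁺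
open import Data.List.NonEmpty using (List⁺; _∷_; toList; head; last; _⁺++_; _++⁺_; _⁺∷ʳ_)
open import Data.List.Relation.Unary.All as All using (All; []; _∷_)
open import Data.List.Relation.Unary.All.Properties
  using () renaming (++⁺ to All-++⁺; ++⁻ˡ to All-++⁻ˡ; ++⁻ʳ to All-++⁻ʳ; map⁺ to All-map⁺; map⁻ to All-map⁻)
open import Relation.Binary.PropositionalEquality
  using (_≡_; _≢_; refl; sym; trans; cong; cong₂; subst; subst₂; module ≡-Reasoning)
open import Relation.Nullary using (¬_; Dec; yes; no)
open import Relation.Nullary.Decidable using (toWitness; fromWitness; isYes)
open import Function using (_∘_)
open import Function.Bundles using (Equivalence)

-- Counting up to a threshold

infix 4 _≈[_]_

_≈[_]_ : ℕ → ℕ → ℕ → Set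
m ≈[ t ] n = m ≡ n ⊎ (t ≤ m × t ≤ n)

≈-refl : ∀ {t m} → m ≈[ t ] m
≈-refl = inj₁ refl

module _ {t m n : ℕ} where

  ≈-sym : m ≈[ t ] n → n ≈[ t ] m
  ≈-sym (inj₁ m≡n) = inj₁ (sym m≡n)
  ≈-sym (inj₂ (t≤m , t≤n)) = inj₂ (t≤n , t≤m)

  ≈-weaken : ∀ {t'} → t' ≤ t → m ≈[ t ] n → m ≈[ t' ] n
  ≈-weaken _ (inj₁ m≡n) = inj₁ m≡n
  ≈-weaken t'≤t (inj₂ (t≤m , t≤n)) = inj₂ (≤-trans t'≤t t≤m , ≤-trans t'≤t t≤n)

  ≈-zero : 1 ≤ t → m ≈[ t ] n → m ≡ 0 → n ≡ 0
  ≈-zero _ (inj₁ refl) m≡0 = m≡0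
  ≈-zero 1≤t (inj₂ (t≤m , _)) refl with ≤-trans 1≤t t≤m
  ... | ()

  ≈-+ : ∀ {m' n'} → m ≈[ t ] n → m' ≈[ t ] n' → m + m' ≈[ t ] n + n'
  ≈-+ (inj₁ refl) (inj₁ refl) = inj₁ refl
  ≈-+ {m'} {n'} (inj₁ refl) (inj₂ (t≤m' , t≤n')) =
    inj₂ (≤-trans t≤m' (m≤n+m m' m) , ≤-trans t≤n' (m≤n+m n' m))
  ≈-+ {m'} {n'} (inj₂ (t≤m , t≤n)) _ = inj₂ (≤-trans t≤m (m≤m+n m m') , ≤-trans t≤n (m≤m+n n n'))

t+t≤a+b⇒a≤t⇒t≤b : ∀ {t a b} → t + t ≤ a + b → a ≤ t → t ≤ b
t+t≤a+b⇒a≤t⇒t≤b {t} {b = b} h a≤t = +-cancelˡ-≤ t t b (≤-trans h (+-monoˡ-≤ b a≤t))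

≈-split : ∀ {t m n m₁ m₂} → m ≈[ t + t ] n → m ≡ m₁ + m₂ →
          ∃₂ λ n₁ n₂ → n ≡ n₁ + n₂ × m₁ ≈[ t ] n₁ × m₂ ≈[ t ] n₂
≈-split (inj₁ refl) m≡ = _ , _ , m≡ , inj₁ refl , inj₁ refl
-- n is cut where m is when one side of that cut is shorter than t, and at t otherwise.
≈-split {t} {n = n} {m₁} {m₂} (inj₂ (t+t≤m , t+t≤n)) refl with m₁ <? t | m₂ <? t
... | yes m₁<t | _ =
  m₁ , n ∸ m₁ , sym (m+[n∸m]≡n m₁≤n) , inj₁ refl ,
  inj₂ (t+t≤a+b⇒a≤t⇒t≤b t+t≤m (<⇒≤ m₁<t) ,
        t+t≤a+b⇒a≤t⇒t≤b (subst (t + t ≤_) (sym (m+[n∸m]≡n m₁≤n)) t+t≤n) (<⇒≤ m₁<t))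
  where
  m₁≤n : m₁ ≤ n
  m₁≤n = ≤-trans (<⇒≤ m₁<t) (≤-trans (m≤m+n t t) t+t≤n)
... | no m₁≮t | yes m₂<t =
  n ∸ m₂ , m₂ , sym (m∸n+n≡m m₂≤n) ,
  inj₂ (≮⇒≥ m₁≮t ,
        t+t≤a+b⇒a≤t⇒t≤b (subst (t + t ≤_) (trans (sym (m∸n+n≡m m₂≤n)) (+-comm (n ∸ m₂) m₂)) t+t≤n)
                          (<⇒≤ m₂<t)) ,
  inj₁ refl
  where
  m₂≤n : m₂ ≤ n
  m₂≤n = ≤-trans (<⇒≤ m₂<t) (≤-trans (m≤m+n t t) t+t≤n)
... | no m₁≮t | no m₂≮t =
  t , n ∸ t , sym (m+[n∸m]≡n t≤n) , inj₂ (≮⇒≥ m₁≮t , ≤-refl) ,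
  inj₂ (≮⇒≥ m₂≮t , t+t≤a+b⇒a≤t⇒t≤b (subst (t + t ≤_) (sym (m+[n∸m]≡n t≤n)) t+t≤n) ≤-refl)
  where
  t≤n : t ≤ n
  t≤n = ≤-trans (m≤m+n t t) t+t≤n

⊓-≈ : ∀ n t → n ⊓ t ≈[ t ] n
⊓-≈ n t with n ≤? t
... | yes n≤t = inj₁ (m≤n⇒m⊓n≡m n≤t)
... | no n≰t = inj₂ (≤-reflexive (sym (m≥n⇒m⊓n≡n (<⇒≤ (≰⇒> n≰t)))) , <⇒≤ (≰⇒> n≰t))

module _ {A : Set} where

  ++-≡-++ : ∀ (xs ys zs ws : List A) → xs ++ ys ≡ zs ++ ws →
            (∃[ m ] xs ≡ zs ++ m × ws ≡ m ++ ys) ⊎ (∃[ m ] zs ≡ xs ++ m × ys ≡ m ++ ws)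
  ++-≡-++ [] ys zs ws eq = inj₂ (zs , refl , eq)
  ++-≡-++ (x ∷ xs) ys [] ws eq = inj₁ (x ∷ xs , refl , sym eq)
  ++-≡-++ (x ∷ xs) ys (z ∷ zs) ws eq with ∷-injective eq
  ... | refl , eq′ with ++-≡-++ xs ys zs ws eq′
  ...   | inj₁ (m , xs≡ , ws≡) = inj₁ (m , cong (x ∷_) xs≡ , ws≡)
  ...   | inj₂ (m , zs≡ , ys≡) = inj₂ (m , cong (x ∷_) zs≡ , ys≡)

  split-by-length : ∀ (xs : List A) m n → length xs ≡ m + n →
                    ∃₂ λ ys zs → xs ≡ ys ++ zs × length ys ≡ m × length zs ≡ n
  split-by-length xs zero n eq = [] , xs , refl , refl , eq
  split-by-length (x ∷ xs) (suc m) n eq with split-by-length xs m n (suc-injective eq)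
  ... | ys , zs , refl , refl , eq′ = x ∷ ys , zs , refl , refl , eq′

  length≡0⇒[] : ∀ {xs : List A} → length xs ≡ 0 → xs ≡ []
  length≡0⇒[] {[]} _ = refl

  ++-nonemptyˡ : ∀ {xs : List A} ys → xs ≢ [] → xs ++ ys ≢ []
  ++-nonemptyˡ {[]} _ xs≢[] = ⊥-elim (xs≢[] refl)
  ++-nonemptyˡ {_ ∷ _} _ _ ()

  ++-∷-nonempty : ∀ (xs : List A) {y ys} → xs ++ y ∷ ys ≢ []
  ++-∷-nonempty [] ()
  ++-∷-nonempty (_ ∷ _) ()

  map-++⁻ : ∀ {B : Set} (f : A → B) xs {ys zs} → map f xs ≡ ys ++ zs →
            ∃₂ λ xs₁ xs₂ → xs ≡ xs₁ ++ xs₂ × map f xs₁ ≡ ys × map f xs₂ ≡ zs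
  map-++⁻ f xs {[]} eq = [] , xs , refl , refl , eq
  map-++⁻ f (x ∷ xs) {_ ∷ _} eq with ∷-injective eq
  ... | refl , eq′ with map-++⁻ f xs eq′
  ...   | xs₁ , xs₂ , refl , map₁≡ , map₂≡ = x ∷ xs₁ , xs₂ , refl , cong (f x ∷_) map₁≡ , map₂≡

  map-nonempty : ∀ {B : Set} (f : A → B) {xs} → xs ≢ [] → map f xs ≢ []
  map-nonempty f {[]} xs≢[] = ⊥-elim (xs≢[] refl)
  map-nonempty f {_ ∷ _} _ ()

module _ {A : Set} where

  last-view : (ρ : List⁺ A) → ∃[ xs ] toList ρ ≡ xs ∷ʳ last ρ
  last-view ρ with List⁺.snocView ρ
  ... | [] List⁺.∷ʳ′ x = [] , refl
  ... | (y ∷ ys) List⁺.∷ʳ′ x = y ∷ ys , refl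

  init⁺ : List⁺ A → List A
  init⁺ ρ = proj₁ (last-view ρ)

  toList≡init⁺∷ʳlast : ∀ ρ → toList ρ ≡ init⁺ ρ ∷ʳ last ρ
  toList≡init⁺∷ʳlast ρ = proj₂ (last-view ρ)

  init⁺-last-unique : ∀ ρ {xs x} → toList ρ ≡ xs ∷ʳ x → init⁺ ρ ≡ xs × last ρ ≡ x
  init⁺-last-unique ρ {xs} eq = ∷ʳ-injective (init⁺ ρ) xs (trans (sym (toList≡init⁺∷ʳlast ρ)) eq)

  toList-⁺∷ʳ : ∀ (ρ : List⁺ A) x → toList (ρ ⁺∷ʳ x) ≡ toList ρ ∷ʳ x
  toList-⁺∷ʳ (_ ∷ _) _ = refl

  All-last : ∀ {P : A → Set} (ρ : List⁺ A) → All P (toList ρ) → P (last ρ)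
  All-last ρ ps with All-++⁻ʳ (init⁺ ρ) (subst (All _) (toList≡init⁺∷ʳlast ρ) ps)
  ... | p ∷ [] = p

  last-⁺∷ʳ : ∀ (ρ : List⁺ A) x → last (ρ ⁺∷ʳ x) ≡ x
  last-⁺∷ʳ ρ x = proj₂ (init⁺-last-unique (ρ ⁺∷ʳ x) {toList ρ} (toList-⁺∷ʳ ρ x))

  head-⁺∷ʳ : ∀ (ρ : List⁺ A) x → head (ρ ⁺∷ʳ x) ≡ head ρ
  head-⁺∷ʳ (_ ∷ _) _ = refl

  toList-++⁺ : ∀ (xs : List A) ρ → toList (xs ++⁺ ρ) ≡ xs ++ toList ρ
  toList-++⁺ [] ρ = refl
  toList-++⁺ (x ∷ xs) ρ = cong (x ∷_) (toList-++⁺ xs ρ)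

  toList-injective : ∀ {ρ ρ' : List⁺ A} → toList ρ ≡ toList ρ' → ρ ≡ ρ'
  toList-injective {_ ∷ _} refl = refl

  toList-nonempty : ∀ (ρ : List⁺ A) → toList ρ ≢ []
  toList-nonempty (_ ∷ _) ()

  last-∷ : ∀ x (ρ : List⁺ A) → last (x ∷ toList ρ) ≡ last ρ
  last-∷ x ρ =
    proj₂ (init⁺-last-unique (x ∷ toList ρ) {x ∷ init⁺ ρ} (cong (x ∷_) (toList≡init⁺∷ʳlast ρ)))

  toList-∷ʳ : ∀ xs (x : A) → toList (xs List⁺.∷ʳ x) ≡ xs ∷ʳ x
  toList-∷ʳ [] _ = refl
  toList-∷ʳ (_ ∷ _) _ = refl

  head-++ : ∀ {ρ ρ' : List⁺ A} {ys} → toList ρ ≡ toList ρ' ++ ys → head ρ ≡ head ρ'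
  head-++ eq = ∷-injectiveˡ eq

-- Lists that agree up to far prefixes

module FarLists {A : Set} (value : A → ℕ) where

  Far : ℕ → A → Set
  Far t x = t < value x

  AllFar : ℕ → List A → Set
  AllFar t = All (Far t)

  AllFar-weaken : ∀ {t t' xs} → t' ≤ t → AllFar t xs → AllFar t' xs
  AllFar-weaken t'≤t = All.map (≤-<-trans t'≤t)

  record FarTwins (t : ℕ) (xs ys : List A) : Set where
    constructor farTwins
    field
      far₁ : AllFar t xs
      far₂ : AllFar t ys
      length≈ : length xs ≈[ t ] length ys

  module _ {t : ℕ} where

    FarTwins-[] : FarTwins t [] []
    FarTwins-[] = farTwins [] [] ≈-refl

    FarTwins-sym : ∀ {xs ys} → FarTwins t xs ys → FarTwins t ys xs
    FarTwins-sym (farTwins f₁ f₂ l) = farTwins f₂ f₁ (≈-sym l)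

    FarTwins-weaken : ∀ {t' xs ys} → t' ≤ t → FarTwins t xs ys → FarTwins t' xs ys
    FarTwins-weaken t'≤t (farTwins f₁ f₂ l) =
      farTwins (AllFar-weaken t'≤t f₁) (AllFar-weaken t'≤t f₂) (≈-weaken t'≤t l)

    FarTwins-++ : ∀ {xs ys xs' ys'} → FarTwins t xs ys → FarTwins t xs' ys' →
                  FarTwins t (xs ++ xs') (ys ++ ys')
    FarTwins-++ {xs} {ys} (farTwins f₁ f₂ l) (farTwins f₁' f₂' l') =
      farTwins (All-++⁺ f₁ f₁') (All-++⁺ f₂ f₂')
        (subst₂ (_≈[ t ]_) (sym (length-++ xs)) (sym (length-++ ys)) (≈-+ l l'))

    FarTwins-nonempty : ∀ {xs ys} → 1 ≤ t → FarTwins t xs ys → xs ≢ [] → ys ≢ []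
    FarTwins-nonempty 1≤t (farTwins _ _ l) xs≢[] refl =
      xs≢[] (length≡0⇒[] (≈-zero 1≤t (≈-sym l) refl))

  FarTwins-split : ∀ {t xs ys xs₁ xs₂} → FarTwins (t + t) xs ys → xs ≡ xs₁ ++ xs₂ →
                   ∃₂ λ ys₁ ys₂ → ys ≡ ys₁ ++ ys₂ × FarTwins t xs₁ ys₁ × FarTwins t xs₂ ys₂
  FarTwins-split {t} {ys = ys} {xs₁} {xs₂} (farTwins f₁ f₂ l) refl
    with ≈-split l (length-++ xs₁)
  ... | n₁ , n₂ , n≡ , l₁ , l₂ with split-by-length ys n₁ n₂ n≡
  ...   | ys₁ , ys₂ , refl , refl , refl =
    ys₁ , ys₂ , refl ,
    farTwins (AllFar-weaken t≤ (All-++⁻ˡ xs₁ f₁)) (AllFar-weaken t≤ (All-++⁻ˡ ys₁ f₂)) l₁ ,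
    farTwins (AllFar-weaken t≤ (All-++⁻ʳ xs₁ f₁)) (AllFar-weaken t≤ (All-++⁻ʳ ys₁ f₂)) l₂
    where
    t≤ : t ≤ t + t
    t≤ = m≤m+n t t

  data FarVariant (t : ℕ) : List A → List A → Set where
    farVariant : ∀ {xs ys} → FarTwins t xs ys → ∀ zs → FarVariant t (xs ++ zs) (ys ++ zs)

  module _ {t : ℕ} where

    FarVariant-refl : ∀ {xs} → FarVariant t xs xs
    FarVariant-refl {xs} = farVariant FarTwins-[] xs

    FarVariant-sym : ∀ {xs ys} → FarVariant t xs ys → FarVariant t ys xs
    FarVariant-sym (farVariant tw zs) = farVariant (FarTwins-sym tw) zs

    FarVariant-weaken : ∀ {t' xs ys} → t' ≤ t → FarVariant t xs ys → FarVariant t' xs ys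
    FarVariant-weaken t'≤t (farVariant tw zs) = farVariant (FarTwins-weaken t'≤t tw) zs

    FarTwins⇒FarVariant : ∀ {xs ys} → FarTwins t xs ys → FarVariant t xs ys
    FarTwins⇒FarVariant {xs} {ys} tw =
      subst₂ (FarVariant t) (++-identityʳ xs) (++-identityʳ ys) (farVariant tw [])

    FarVariant-++ʳ : ∀ {xs ys} zs → FarVariant t xs ys → FarVariant t (xs ++ zs) (ys ++ zs)
    FarVariant-++ʳ zs (farVariant {xs} {ys} tw ws) =
      subst₂ (FarVariant t) (sym (++-assoc xs ws zs)) (sym (++-assoc ys ws zs)) (farVariant tw (ws ++ zs))

    FarTwins-++-FarVariant : ∀ {xs ys xs' ys'} → FarTwins t xs ys → FarVariant t xs' ys' →
                             FarVariant t (xs ++ xs') (ys ++ ys')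
    FarTwins-++-FarVariant {xs} {ys} tw (farVariant {xs'} {ys'} tw' zs) =
      subst₂ (FarVariant t) (++-assoc xs xs' zs) (++-assoc ys ys' zs) (farVariant (FarTwins-++ tw tw') zs)

    FarVariant-nonempty : ∀ {xs ys} → 1 ≤ t → FarVariant t xs ys → xs ≢ [] → ys ≢ []
    FarVariant-nonempty 1≤t (farVariant tw []) xs≢[] =
      subst (_≢ []) (sym (++-identityʳ _))
        (FarTwins-nonempty 1≤t tw (subst (_≢ []) (++-identityʳ _) xs≢[]))
    FarVariant-nonempty 1≤t (farVariant {ys = ys} tw (_ ∷ _)) _ = ++-∷-nonempty ys

  FarVariant-split : ∀ {t xs ys xs₁ xs₂} → FarVariant (t + t) xs ys → xs ≡ xs₁ ++ xs₂ →
    ∃₂ λ ys₁ ys₂ → ys ≡ ys₁ ++ ys₂ ×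
      (FarTwins t xs₁ ys₁ × FarVariant t xs₂ ys₂ ⊎ ys₂ ≡ xs₂ × FarVariant t xs₁ ys₁)
  FarVariant-split {t} {xs₁ = xs₁} {xs₂} (farVariant {xs} {ys} tw zs) eq
    with ++-≡-++ xs zs xs₁ xs₂ eq
  ... | inj₁ (m , refl , refl) with FarTwins-split tw refl
  ...   | ys₁ , ys₂ , refl , tw₁ , tw₂ =
    ys₁ , ys₂ ++ zs , ++-assoc ys₁ ys₂ zs , inj₁ (tw₁ , farVariant tw₂ zs)
  FarVariant-split {t} {xs₁ = xs₁} {xs₂} (farVariant {xs} {ys} tw zs) eq
    | inj₂ (m , refl , refl) =
    ys ++ m , xs₂ , sym (++-assoc ys m xs₂) ,
    inj₂ (refl , farVariant (FarTwins-weaken (m≤m+n t t) tw) m)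

  FarVariant-split′ : ∀ {t xs ys xs₁ xs₂} → FarVariant (t + t) xs ys → xs ≡ xs₁ ++ xs₂ →
    ∃₂ λ ys₁ ys₂ → ys ≡ ys₁ ++ ys₂ × FarVariant t xs₁ ys₁ × FarVariant t xs₂ ys₂
  FarVariant-split′ v eq with FarVariant-split v eq
  ... | ys₁ , ys₂ , ys≡ , inj₁ (tw , v₂) = ys₁ , ys₂ , ys≡ , FarTwins⇒FarVariant tw , v₂
  ... | ys₁ , ys₂ , ys≡ , inj₂ (refl , v₁) = ys₁ , ys₂ , ys≡ , v₁ , FarVariant-refl

  span-Far : ∀ t xs →
             AllFar t xs ⊎ ∃₂ λ s y → ∃[ ys ] xs ≡ s ++ y ∷ ys × AllFar t s × value y ≤ t
  span-Far t [] = inj₁ []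
  span-Far t (x ∷ xs) with t <? value x
  ... | no x≮ = inj₂ ([] , x , xs , refl , [] , ≮⇒≥ x≮)
  ... | yes x-far with span-Far t xs
  ...   | inj₁ xs-far = inj₁ (x-far ∷ xs-far)
  ...   | inj₂ (s , y , ys , refl , s-far , y≤t) = inj₂ (x ∷ s , y , ys , refl , x-far ∷ s-far , y≤t)

module _ {AP : Set} (K : Kripke AP) where
  open Kripke K

  IsPath-++⁻ˡ : ∀ xs {ys} → IsPath K (xs ++ ys) → IsPath K xs
  IsPath-++⁻ˡ [] _ = []
  IsPath-++⁻ˡ (x ∷ []) _ = single x
  IsPath-++⁻ˡ (x ∷ x' ∷ xs) (step d p) = step d (IsPath-++⁻ˡ (x' ∷ xs) p)

  IsPath-++⁻ʳ : ∀ xs {ys} → IsPath K (xs ++ ys) → IsPath K ys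
  IsPath-++⁻ʳ [] p = p
  IsPath-++⁻ʳ (x ∷ []) {[]} _ = []
  IsPath-++⁻ʳ (x ∷ []) {_ ∷ _} (step _ p) = p
  IsPath-++⁻ʳ (x ∷ x' ∷ xs) (step _ p) = IsPath-++⁻ʳ (x' ∷ xs) p

  IsPath-glue : ∀ xs ys {zs} → ys ≢ [] → IsPath K (xs ++ ys) → IsPath K (ys ++ zs) →
                IsPath K (xs ++ ys ++ zs)
  IsPath-glue [] ys _ _ q = q
  IsPath-glue (x ∷ []) [] ys≢[] _ _ = ⊥-elim (ys≢[] refl)
  IsPath-glue (x ∷ []) (_ ∷ _) _ (step d _) q = step d q
  IsPath-glue (x ∷ x' ∷ xs) ys ys≢[] (step d p) q = step d (IsPath-glue (x' ∷ xs) ys ys≢[] p q)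

  IsPath-join : ∀ ρ {ys} → IsPath K (toList ρ) → IsPath K (last ρ ∷ ys) → IsPath K (toList ρ ++ ys)
  IsPath-join ρ {ys} p q =
    subst (IsPath K) (sym (trans (cong (_++ ys) (toList≡init⁺∷ʳlast ρ)) (++-assoc (init⁺ ρ) _ ys)))
      (IsPath-glue (init⁺ ρ) (last ρ ∷ []) (λ ()) (subst (IsPath K) (toList≡init⁺∷ʳlast ρ) p) q)

  IsPath-last-step : ∀ ρ {y ys} → IsPath K (toList ρ ++ y ∷ ys) → δ (last ρ) y
  IsPath-last-step ρ {y} {ys} p
    with IsPath-++⁻ʳ (init⁺ ρ)
           (subst (IsPath K)
              (trans (cong (_++ y ∷ ys) (toList≡init⁺∷ʳlast ρ)) (++-assoc (init⁺ ρ) _ (y ∷ ys))) p)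
  ... | step d _ = d

  IsTrace-⁺∷ʳ : ∀ ρ {y} → IsTrace K ρ → δ (last ρ) y → IsTrace K (ρ ⁺∷ʳ y)
  IsTrace-⁺∷ʳ ρ {y} tr d = subst (IsPath K) (sym (toList-⁺∷ʳ ρ y)) (IsPath-join ρ tr (step d (single y)))

IsPath-reroot : ∀ {AP} (K : Kripke AP) {s l} → IsPath K l → IsPath (record K { s₀ = s }) l
IsPath-reroot K [] = []
IsPath-reroot K (single x) = single x
IsPath-reroot K (step d p) = step d (IsPath-reroot K p)

-- Interval systems and back-and-forth games

record IntervalSystem (AP : Set) : Set₁ where
  field
    Interval : Set
    holds : AP → Interval → Set
    _⟶B_ _⟶E_ _⟶B̄_ _⟶Ē_ : Interval → Interval → Set

depth : ∀ {AP} → HS AP → ℕ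
depth (atom _) = 0
depth (¬' φ) = depth φ
depth (φ ∧' ψ) = depth φ ⊔ depth ψ
depth (⟨B⟩ φ) = suc (depth φ)
depth (⟨E⟩ φ) = suc (depth φ)
depth (⟨B̄⟩ φ) = suc (depth φ)
depth (⟨Ē⟩ φ) = suc (depth φ)

module _ {AP : Set} (𝕀 : IntervalSystem AP) where
  open IntervalSystem 𝕀

  Diamond : (Interval → Interval → Set) → (Interval → Set) → Interval → Set
  Diamond _⟶_ P i = ∃[ j ] i ⟶ j × P j

  Sat : HS AP → Interval → Set
  Sat (atom p) = holds p
  Sat (¬' φ) i = ¬ Sat φ i
  Sat (φ ∧' ψ) i = Sat φ i × Sat ψ i
  Sat (⟨B⟩ φ) = Diamond _⟶B_ (Sat φ)
  Sat (⟨E⟩ φ) = Diamond _⟶E_ (Sat φ)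
  Sat (⟨B̄⟩ φ) = Diamond _⟶B̄_ (Sat φ)
  Sat (⟨Ē⟩ φ) = Diamond _⟶Ē_ (Sat φ)

  Zig : (ℕ → Interval → Interval → Set) → (Interval → Interval → Set) → Set
  Zig R _⟶_ = ∀ {t i i' j} → 1 ≤ t → R (t + t) i i' → i ⟶ j → ∃[ j' ] i' ⟶ j' × R t j j'

  record IsBackAndForth (R : ℕ → Interval → Interval → Set) : Set where
    field
      symmetric : ∀ {t i i'} → R t i i' → R t i' i
      weaken : ∀ {t t' i i'} → t' ≤ t → R t i i' → R t' i i'
      holds-resp : ∀ {t i i'} p → 1 ≤ t → R t i i' → holds p i → holds p i'
      zigB : Zig R _⟶B_
      zigE : Zig R _⟶E_
      zigB̄ : Zig R _⟶B̄_
      zigĒ : Zig R _⟶Ē_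

  module _ {R : ℕ → Interval → Interval → Set} (bf : IsBackAndForth R) where
    open IsBackAndForth bf

    Sat-resp : ∀ φ {t i i'} → 2 ^ depth φ ≤ t → R t i i' → Sat φ i → Sat φ i'
    Diamond-resp : ∀ {_⟶_} → Zig R _⟶_ → ∀ φ {t i i'} → 2 ^ suc (depth φ) ≤ t → R t i i' →
                   Diamond _⟶_ (Sat φ) i → Diamond _⟶_ (Sat φ) i'

    Sat-resp (atom p) bound r = holds-resp p (≤-trans (m^n>0 2 0) bound) r
    Sat-resp (¬' φ) bound r s s' = s (Sat-resp φ bound (symmetric r) s')
    Sat-resp (φ ∧' ψ) bound r (sφ , sψ) =
      Sat-resp φ (≤-trans (^-monoʳ-≤ 2 (m≤m⊔n (depth φ) (depth ψ))) bound) r sφ ,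
      Sat-resp ψ (≤-trans (^-monoʳ-≤ 2 (m≤n⊔m (depth φ) (depth ψ))) bound) r sψ
    Sat-resp (⟨B⟩ φ) = Diamond-resp zigB φ
    Sat-resp (⟨E⟩ φ) = Diamond-resp zigE φ
    Sat-resp (⟨B̄⟩ φ) = Diamond-resp zigB̄ φ
    Sat-resp (⟨Ē⟩ φ) = Diamond-resp zigĒ φ

    Diamond-resp zig φ bound r (j , i⟶j , s)
      with zig (m^n>0 2 (depth φ)) (weaken (≤-trans double≤ bound) r) i⟶j
      where
      double≤ : 2 ^ depth φ + 2 ^ depth φ ≤ 2 ^ suc (depth φ)
      double≤ = ≤-reflexive (cong (2 ^ depth φ +_) (sym (+-identityʳ (2 ^ depth φ))))
    ... | j' , i'⟶j' , r' = j' , i'⟶j' , Sat-resp φ ≤-refl r' s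

-- HS_st and HS_ct as interval systems

module _ {AP : Set} (K : Kripke AP) where
  open Kripke K

  Labelled : AP → List S → Set
  Labelled p = All (λ x → μ x p ≡ true)

  traceSystem : IntervalSystem AP
  traceSystem = record
    { Interval = List S
    ; holds = Labelled
    ; _⟶B_ = λ β γ → γ ≢ [] × ∃[ σ ] σ ≢ [] × β ≡ γ ++ σ
    ; _⟶E_ = λ β γ → γ ≢ [] × ∃[ σ ] σ ≢ [] × β ≡ σ ++ γ
    ; _⟶B̄_ = λ β γ → IsPath K γ × ∃[ σ ] σ ≢ [] × γ ≡ β ++ σ
    ; _⟶Ē_ = λ β γ → IsPath K γ × ∃[ σ ] σ ≢ [] × γ ≡ σ ++ β
    }

  satSt⇒Sat : ∀ φ ρ → satSt K φ ρ → Sat traceSystem φ (toList ρ)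
  Sat⇒satSt : ∀ φ ρ → Sat traceSystem φ (toList ρ) → satSt K φ ρ

  satSt⇒Sat (atom p) ρ s = s
  satSt⇒Sat (¬' φ) ρ s s' = s (Sat⇒satSt φ ρ s')
  satSt⇒Sat (φ ∧' ψ) ρ (sφ , sψ) = satSt⇒Sat φ ρ sφ , satSt⇒Sat ψ ρ sψ
  satSt⇒Sat (⟨B⟩ φ) ρ (ρ' , σ , σ≢[] , refl , s) =
    toList ρ' , (toList-nonempty ρ' , σ , σ≢[] , refl) , satSt⇒Sat φ ρ' s
  satSt⇒Sat (⟨E⟩ φ) ρ (σ , ρ' , σ≢[] , refl , s) =
    toList ρ' , (toList-nonempty ρ' , σ , σ≢[] , toList-++⁺ σ ρ') , satSt⇒Sat φ ρ' s
  satSt⇒Sat (⟨B̄⟩ φ) ρ (σ , σ≢[] , tr , s) =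
    toList (ρ ⁺++ σ) , (tr , σ , σ≢[] , refl) , satSt⇒Sat φ (ρ ⁺++ σ) s
  satSt⇒Sat (⟨Ē⟩ φ) ρ (σ , σ≢[] , tr , s) =
    toList (σ ++⁺ ρ) , (tr , σ , σ≢[] , toList-++⁺ σ ρ) , satSt⇒Sat φ (σ ++⁺ ρ) s

  Sat⇒satSt (atom p) ρ s = s
  Sat⇒satSt (¬' φ) ρ s s' = s (satSt⇒Sat φ ρ s')
  Sat⇒satSt (φ ∧' ψ) ρ (sφ , sψ) = Sat⇒satSt φ ρ sφ , Sat⇒satSt ψ ρ sψ
  Sat⇒satSt (⟨B⟩ φ) ρ ([] , (γ≢[] , _) , _) = ⊥-elim (γ≢[] refl)
  Sat⇒satSt (⟨B⟩ φ) ρ (x ∷ xs , (_ , σ , σ≢[] , ρ≡) , s) =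
    x ∷ xs , σ , σ≢[] , toList-injective ρ≡ , Sat⇒satSt φ (x ∷ xs) s
  Sat⇒satSt (⟨E⟩ φ) ρ ([] , (γ≢[] , _) , _) = ⊥-elim (γ≢[] refl)
  Sat⇒satSt (⟨E⟩ φ) ρ (x ∷ xs , (_ , σ , σ≢[] , ρ≡) , s) =
    σ , x ∷ xs , σ≢[] , toList-injective (trans ρ≡ (sym (toList-++⁺ σ (x ∷ xs)))) ,
    Sat⇒satSt φ (x ∷ xs) s
  Sat⇒satSt (⟨B̄⟩ φ) ρ (γ , (path , σ , σ≢[] , refl) , s) =
    σ , σ≢[] , path , Sat⇒satSt φ (ρ ⁺++ σ) s
  Sat⇒satSt (⟨Ē⟩ φ) ρ (γ , (path , σ , σ≢[] , refl) , s) =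
    σ , σ≢[] , subst (IsPath K) (sym (toList-++⁺ σ ρ)) path ,
    Sat⇒satSt φ (σ ++⁺ ρ) (subst (Sat traceSystem φ) (sym (toList-++⁺ σ ρ)) s)

  pair⟶B pair⟶E pair⟶B̄ pair⟶Ē : List S × List S → List S × List S → Set
  pair⟶B (A , B) (A₁ , B₁) = A₁ ≡ A × B₁ ≢ [] × ∃[ σ ] σ ≢ [] × B ≡ B₁ ++ σ
  pair⟶E (A , B) (A₁ , B₁) = B₁ ≢ [] × ∃[ σ ] σ ≢ [] × B ≡ σ ++ B₁ × A₁ ≡ A ++ σ
  pair⟶B̄ (A , B) (A₁ , B₁) = A₁ ≡ A × IsPath K (A ++ B₁) × ∃[ σ ] σ ≢ [] × B₁ ≡ B ++ σ
  pair⟶Ē (A , B) (A₁ , B₁) = ∃[ α ] α ≢ [] × A ≡ A₁ ++ α × B₁ ≡ α ++ B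

  -- (A , B) stands for the trace of C(K) whose states are the initial traces
  -- A ++ B₀ for the non-empty prefixes B₀ of B.
  pairSystem : IntervalSystem AP
  pairSystem = record
    { Interval = List S × List S
    ; holds = λ p → Labelled p ∘ proj₂
    ; _⟶B_ = pair⟶B
    ; _⟶E_ = pair⟶E
    ; _⟶B̄_ = pair⟶B̄
    ; _⟶Ē_ = pair⟶Ē
    }

module CompTreeTraces {AP : Set} (K : Kripke AP) where
  open Kripke K

  C : Kripke AP
  C = CompTree K

  Node : Set
  Node = Kripke.S C

  CPath : List Node → Set
  CPath = IsPath C

  trace : Node → List⁺ S
  trace = proj₁

  tip : Node → S
  tip u = last (trace u)

  history : Node → List S
  history u = init⁺ (trace u)

  trace≡history∷ʳtip : ∀ u → toList (trace u) ≡ history u ∷ʳ tip u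
  trace≡history∷ʳtip u = toList≡init⁺∷ʳlast (trace u)

  trace-path : ∀ u → IsPath K (toList (trace u))
  trace-path u = proj₁ (proj₂ u)

  step-history : ∀ {u v} → Kripke.δ C u v → history v ≡ toList (trace u)
  step-history {u} {v} (s , _ , refl) = proj₁ (init⁺-last-unique (trace v) (toList-⁺∷ʳ (trace u) s))

  step-history-++ : ∀ {u v} → Kripke.δ C u v → ∀ vs →
                    history v ++ map tip vs ≡ history u ++ map tip (u ∷ vs)
  step-history-++ {u} {v} d vs = begin
    history v ++ map tip vs             ≡⟨ cong (_++ map tip vs) (step-history {u} {v} d) ⟩
    toList (trace u) ++ map tip vs      ≡⟨ cong (_++ map tip vs) (trace≡history∷ʳtip u) ⟩
    (history u ∷ʳ tip u) ++ map tip vs  ≡⟨ ++-assoc (history u) (tip u ∷ []) (map tip vs) ⟩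
    history u ++ map tip (u ∷ vs)       ∎
    where open ≡-Reasoning

  CPath-history : ∀ u us v {vs} → CPath (u ∷ us ++ v ∷ vs) → history v ≡ history u ++ map tip (u ∷ us)
  CPath-history u [] v (step d _) = trans (step-history {u} {v} d) (trace≡history∷ʳtip u)
  CPath-history u (w ∷ ws) v (step d p) = trans (CPath-history w ws v p) (step-history-++ {u} {w} d (w ∷ ws))

  trace-last : ∀ u us → CPath (u ∷ us) → toList (trace (last (u ∷ us))) ≡ history u ++ map tip (u ∷ us)
  trace-last u [] _ = trace≡history∷ʳtip u
  trace-last u (w ∷ ws) (step d p) =
    trans (cong (toList ∘ trace) (last-∷ u (w ∷ ws)))
          (trans (trace-last w ws p) (step-history-++ {u} {w} d (w ∷ ws)))

  CPath-trail : ∀ u us → CPath (u ∷ us) → IsPath K (history u ++ map tip (u ∷ us))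
  CPath-trail u us p = subst (IsPath K) (trace-last u us p) (trace-path (last (u ∷ us)))

  child : ∀ u {x xs} → IsPath K (toList (trace u) ++ x ∷ xs) → Node
  child (ρ , tr , root) {x} p =
    ρ ⁺∷ʳ x , IsTrace-⁺∷ʳ K ρ tr (IsPath-last-step K ρ p) , trans (head-⁺∷ʳ ρ x) root

  child-path : ∀ u {x xs} (p : IsPath K (toList (trace u) ++ x ∷ xs)) →
               IsPath K (toList (trace (child u p)) ++ xs)
  child-path u {x} {xs} p =
    subst (IsPath K)
      (trans (sym (++-assoc (toList (trace u)) (x ∷ []) xs)) (cong (_++ xs) (sym (toList-⁺∷ʳ (trace u) x)))) p

  grow : ∀ u xs → IsPath K (toList (trace u) ++ xs) → List Node
  grow u [] _ = []
  grow u (x ∷ xs) p = child u p ∷ grow (child u p) xs (child-path u p)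

  grow-path : ∀ u xs p → CPath (u ∷ grow u xs p)
  grow-path u [] _ = single u
  grow-path u (x ∷ xs) p =
    step (x , IsPath-last-step K (trace u) p , refl) (grow-path (child u p) xs (child-path u p))

  grow-tips : ∀ u xs p → map tip (grow u xs p) ≡ xs
  grow-tips u [] _ = refl
  grow-tips u (x ∷ xs) p = cong₂ _∷_ (last-⁺∷ʳ (trace u) x) (grow-tips (child u p) xs (child-path u p))

  trace-grow-last : ∀ u xs p → toList (trace (last (u ∷ grow u xs p))) ≡ toList (trace u) ++ xs
  trace-grow-last u xs p = begin
    toList (trace (last (u ∷ grow u xs p)))      ≡⟨ trace-last u _ (grow-path u xs p) ⟩
    history u ++ tip u ∷ map tip (grow u xs p)  ≡⟨ cong (λ ys → history u ++ tip u ∷ ys) (grow-tips u xs p) ⟩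
    history u ++ tip u ∷ xs                     ≡⟨ sym (++-assoc (history u) (tip u ∷ []) xs) ⟩
    (history u ∷ʳ tip u) ++ xs                  ≡⟨ cong (_++ xs) (sym (trace≡history∷ʳtip u)) ⟩
    toList (trace u) ++ xs                      ∎
    where open ≡-Reasoning

  prefix-node : ∀ u ρ {ys} → toList (trace u) ≡ toList ρ ++ ys → Node
  prefix-node u ρ eq =
    ρ , IsPath-++⁻ˡ K (toList ρ) (subst (IsPath K) eq (trace-path u)) ,
    trans (sym (head-++ {ρ = trace u} {ρ} eq)) (proj₂ (proj₂ u))

  CPath-extend : ∀ h t {xs} → CPath (h ∷ t) → IsPath K (history h ++ map tip (h ∷ t) ++ xs) →
                 ∃[ us ] CPath (h ∷ t ++ us) × map tip us ≡ xs
  CPath-extend h t {xs} p q = grow w xs q' , IsPath-join C (h ∷ t) p (grow-path w xs q') , grow-tips w xs q'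
    where
    w = last (h ∷ t)
    q' : IsPath K (toList (trace w) ++ xs)
    q' = subst (IsPath K) (trans (sym (++-assoc (history h) (map tip (h ∷ t)) xs))
                                 (cong (_++ xs) (sym (trace-last h t p)))) q

  CPath-prepend : ∀ h t {A₁ a αs} → CPath (h ∷ t) → history h ≡ A₁ ++ a ∷ αs →
                  ∃₂ λ v us → CPath (v ∷ us ++ h ∷ t) × history v ≡ A₁ ×
                               map tip (v ∷ us) ≡ a ∷ αs
  CPath-prepend h t {A₁} {a} {αs} p A≡ =
    v , us , IsPath-join C (v ∷ us) (grow-path v αs q) (step step-w p) ,
    proj₁ v-history , cong₂ _∷_ (proj₂ v-history) (grow-tips v αs q)
    where
    trace-h : toList (trace h) ≡ toList (A₁ List⁺.∷ʳ a) ++ αs ∷ʳ tip h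
    trace-h = begin
      toList (trace h)                       ≡⟨ trace≡history∷ʳtip h ⟩
      history h ∷ʳ tip h                     ≡⟨ cong (_∷ʳ tip h) A≡ ⟩
      (A₁ ++ a ∷ αs) ∷ʳ tip h                ≡⟨ cong (_∷ʳ tip h) (sym (++-assoc A₁ (a ∷ []) αs)) ⟩
      ((A₁ ∷ʳ a) ++ αs) ∷ʳ tip h             ≡⟨ ++-assoc (A₁ ∷ʳ a) αs (tip h ∷ []) ⟩
      (A₁ ∷ʳ a) ++ αs ∷ʳ tip h               ≡⟨ cong (_++ αs ∷ʳ tip h) (sym (toList-∷ʳ A₁ a)) ⟩
      toList (A₁ List⁺.∷ʳ a) ++ αs ∷ʳ tip h  ∎
      where open ≡-Reasoning
    v : Node
    v = prefix-node h (A₁ List⁺.∷ʳ a) trace-h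
    v-history : history v ≡ A₁ × tip v ≡ a
    v-history = init⁺-last-unique (A₁ List⁺.∷ʳ a) (toList-∷ʳ A₁ a)
    q : IsPath K (toList (trace v) ++ αs)
    q = IsPath-++⁻ˡ K (toList (trace v) ++ αs)
          (subst (IsPath K) (trans trace-h (sym (++-assoc (toList (trace v)) αs (tip h ∷ [])))) (trace-path h))
    us = grow v αs q
    w = last (v ∷ us)
    trace-w : toList (trace w) ++ tip h ∷ [] ≡ toList (trace h)
    trace-w = trans (cong (_++ tip h ∷ []) (trace-grow-last v αs q))
                    (trans (++-assoc (toList (trace v)) αs (tip h ∷ [])) (sym trace-h))
    step-w : Kripke.δ C w h
    step-w = tip h , IsPath-last-step K (trace w) (subst (IsPath K) (sym trace-w) (trace-path h)) ,
             toList-injective (trans (sym trace-w) (sym (toList-⁺∷ʳ (trace w) (tip h))))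

  project : List⁺ Node → List S × List S
  project Λ = history (head Λ) , map tip (toList Λ)

  tips-++⁺ : ∀ us Λ → map tip (toList (us ++⁺ Λ)) ≡ map tip us ++ map tip (toList Λ)
  tips-++⁺ us Λ = trans (cong (map tip) (toList-++⁺ us Λ)) (map-++ tip us (toList Λ))

  private
    Satᴾ : HS AP → List S × List S → Set
    Satᴾ = Sat (pairSystem K)

  satCt⇒Sat : ∀ φ Λ → CPath (toList Λ) → satSt C φ Λ → Satᴾ φ (project Λ)
  Sat⇒satCt : ∀ φ Λ → CPath (toList Λ) → Satᴾ φ (project Λ) → satSt C φ Λ

  satCt⇒Sat (atom p) Λ _ = All-map⁺
  satCt⇒Sat (¬' φ) Λ p s s' = s (Sat⇒satCt φ Λ p s')
  satCt⇒Sat (φ ∧' ψ) Λ p (sφ , sψ) = satCt⇒Sat φ Λ p sφ , satCt⇒Sat ψ Λ p sψ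
  satCt⇒Sat (⟨B⟩ φ) Λ p (Λ₁ , σ , σ≢[] , refl , s) =
    project Λ₁ , (refl , (λ ()) , map tip σ , map-nonempty tip σ≢[] , map-++ tip (toList Λ₁) σ) ,
    satCt⇒Sat φ Λ₁ (IsPath-++⁻ˡ C (toList Λ₁) p) s
  satCt⇒Sat (⟨E⟩ φ) Λ p ([] , _ , σ≢[] , _) = ⊥-elim (σ≢[] refl)
  satCt⇒Sat (⟨E⟩ φ) Λ p (u ∷ us , Λ₁ , _ , refl , s) =
    project Λ₁ ,
    ((λ ()) , map tip (u ∷ us) , (λ ()) , tips-++⁺ (u ∷ us) Λ₁ , CPath-history u us (head Λ₁) p') ,
    satCt⇒Sat φ Λ₁ (IsPath-++⁻ʳ C (u ∷ us) p') s
    where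
    p' : CPath (u ∷ us ++ toList Λ₁)
    p' = subst CPath (toList-++⁺ (u ∷ us) Λ₁) p
  satCt⇒Sat (⟨B̄⟩ φ) Λ p (σ , σ≢[] , p' , s) =
    project (Λ ⁺++ σ) ,
    (refl , CPath-trail (head Λ) _ p' , map tip σ , map-nonempty tip σ≢[] , map-++ tip (toList Λ) σ) ,
    satCt⇒Sat φ (Λ ⁺++ σ) p' s
  satCt⇒Sat (⟨Ē⟩ φ) Λ p ([] , σ≢[] , _) = ⊥-elim (σ≢[] refl)
  satCt⇒Sat (⟨Ē⟩ φ) Λ p (u ∷ us , _ , p' , s) =
    project ((u ∷ us) ++⁺ Λ) ,
    (map tip (u ∷ us) , (λ ()) , CPath-history u us (head Λ) (subst CPath (toList-++⁺ (u ∷ us) Λ) p') ,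
     tips-++⁺ (u ∷ us) Λ) ,
    satCt⇒Sat φ _ p' s

  Sat⇒satCt (atom p) Λ _ = All-map⁻
  Sat⇒satCt (¬' φ) Λ p s s' = s (satCt⇒Sat φ Λ p s')
  Sat⇒satCt (φ ∧' ψ) Λ p (sφ , sψ) = Sat⇒satCt φ Λ p sφ , Sat⇒satCt ψ Λ p sψ
  Sat⇒satCt (⟨B⟩ φ) Λ p ((_ , B₁) , (refl , B₁≢[] , σK , σK≢[] , B≡) , s)
    with map-++⁻ tip (toList Λ) {B₁} {σK} B≡
  ... | [] , _ , _ , refl , _ = ⊥-elim (B₁≢[] refl)
  ... | u ∷ us , σ , Λ≡ , refl , refl =
    u ∷ us , σ , (λ σ≡[] → σK≢[] (cong (map tip) σ≡[])) , toList-injective Λ≡ ,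
    Sat⇒satCt φ (u ∷ us) (IsPath-++⁻ˡ C (u ∷ us) (subst CPath Λ≡ p))
      (subst (λ v → Satᴾ φ (history v , map tip (u ∷ us))) (∷-injectiveˡ Λ≡) s)
  Sat⇒satCt (⟨E⟩ φ) Λ p ((_ , B₁) , (B₁≢[] , σK , σK≢[] , B≡ , refl) , s)
    with map-++⁻ tip (toList Λ) {σK} {B₁} B≡
  ... | [] , _ , _ , refl , _ = ⊥-elim (σK≢[] refl)
  ... | _ , [] , _ , _ , refl = ⊥-elim (B₁≢[] refl)
  ... | u ∷ us , y ∷ ys , Λ≡ , refl , refl =
    u ∷ us , y ∷ ys , (λ ()) , toList-injective (trans Λ≡ (sym (toList-++⁺ (u ∷ us) (y ∷ ys)))) ,
    Sat⇒satCt φ (y ∷ ys) (IsPath-++⁻ʳ C (u ∷ us) p')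
      (subst (λ A → Satᴾ φ (A , map tip (y ∷ ys))) history-y s)
    where
    p' : CPath (u ∷ us ++ y ∷ ys)
    p' = subst CPath Λ≡ p
    history-y : history (head Λ) ++ map tip (u ∷ us) ≡ history y
    history-y = sym (trans (CPath-history u us y p')
                           (cong (λ v → history v ++ map tip (u ∷ us)) (sym (∷-injectiveˡ Λ≡))))
  Sat⇒satCt (⟨B̄⟩ φ) (h ∷ t) p (_ , (refl , q , σK , σK≢[] , refl) , s) with CPath-extend h t p q
  ... | us , path , tips =
    us , (λ us≡[] → σK≢[] (trans (sym tips) (cong (map tip) us≡[]))) , path ,
    Sat⇒satCt φ _ path
      (subst (λ B → Satᴾ φ (history h , B))
             (sym (trans (map-++ tip (h ∷ t) us) (cong (map tip (h ∷ t) ++_) tips))) s)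
  Sat⇒satCt (⟨Ē⟩ φ) Λ p (_ , ([] , α≢[] , _) , _) = ⊥-elim (α≢[] refl)
  Sat⇒satCt (⟨Ē⟩ φ) (h ∷ t) p ((A₁ , _) , (a ∷ αs , _ , A≡ , refl) , s) with CPath-prepend h t p A≡
  ... | v , us , path , history-v , tips =
    v ∷ us , (λ ()) , path' , Sat⇒satCt φ _ path' (subst (Satᴾ φ) (sym projected) s)
    where
    path' : CPath (toList ((v ∷ us) ++⁺ (h ∷ t)))
    path' = subst CPath (sym (toList-++⁺ (v ∷ us) (h ∷ t))) path
    projected : project ((v ∷ us) ++⁺ (h ∷ t)) ≡ (A₁ , (a ∷ αs) ++ map tip (h ∷ t))
    projected = cong₂ _,_ history-v (trans (tips-++⁺ (v ∷ us) (h ∷ t)) (cong (_++ map tip (h ∷ t)) tips))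

module _ {AP : Set} where

  Sat-trace-reroot : ∀ (K : Kripke AP) s φ {β} →
                     Sat (traceSystem K) φ β → Sat (traceSystem (record K { s₀ = s })) φ β
  Sat-trace-reroot K s (atom p) sat = sat
  Sat-trace-reroot K s (¬' φ) sat sat' = sat (Sat-trace-reroot (record K { s₀ = s }) (Kripke.s₀ K) φ sat')
  Sat-trace-reroot K s (φ ∧' ψ) (sφ , sψ) = Sat-trace-reroot K s φ sφ , Sat-trace-reroot K s ψ sψ
  Sat-trace-reroot K s (⟨B⟩ φ) (γ , move , sat) = γ , move , Sat-trace-reroot K s φ sat
  Sat-trace-reroot K s (⟨E⟩ φ) (γ , move , sat) = γ , move , Sat-trace-reroot K s φ sat
  Sat-trace-reroot K s (⟨B̄⟩ φ) (γ , (p , move) , sat) =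
    γ , (IsPath-reroot K p , move) , Sat-trace-reroot K s φ sat
  Sat-trace-reroot K s (⟨Ē⟩ φ) (γ , (p , move) , sat) =
    γ , (IsPath-reroot K p , move) , Sat-trace-reroot K s φ sat

  Sat-pair-reroot : ∀ (K : Kripke AP) s φ {P} →
                    Sat (pairSystem K) φ P → Sat (pairSystem (record K { s₀ = s })) φ P
  Sat-pair-reroot K s (atom p) sat = sat
  Sat-pair-reroot K s (¬' φ) sat sat' = sat (Sat-pair-reroot (record K { s₀ = s }) (Kripke.s₀ K) φ sat')
  Sat-pair-reroot K s (φ ∧' ψ) (sφ , sψ) = Sat-pair-reroot K s φ sφ , Sat-pair-reroot K s ψ sψ
  Sat-pair-reroot K s (⟨B⟩ φ) (Q , move , sat) = Q , move , Sat-pair-reroot K s φ sat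
  Sat-pair-reroot K s (⟨E⟩ φ) (Q , move , sat) = Q , move , Sat-pair-reroot K s φ sat
  Sat-pair-reroot K s (⟨B̄⟩ φ) (Q , (A≡ , p , move) , sat) =
    Q , (A≡ , IsPath-reroot K p , move) , Sat-pair-reroot K s φ sat
  Sat-pair-reroot K s (⟨Ē⟩ φ) (Q , move , sat) = Q , move , Sat-pair-reroot K s φ sat

-- HS_lin and homomorphisms

module _ {AP : Set} where

  satLin-labels : ∀ (K K' : Kripke AP) π π' →
                  (∀ h q → Kripke.μ K (π h) q ≡ Kripke.μ K' (π' h) q) →
                  ∀ φ {i j} → satLin K π φ i j → satLin K' π' φ i j
  satLin-labels K K' π π' same (atom p) s h i≤h h≤j = trans (sym (same h p)) (s h i≤h h≤j)
  satLin-labels K K' π π' same (¬' φ) s s' = s (satLin-labels K' K π' π (λ h q → sym (same h q)) φ s')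
  satLin-labels K K' π π' same (φ ∧' ψ) (sφ , sψ) =
    satLin-labels K K' π π' same φ sφ , satLin-labels K K' π π' same ψ sψ
  satLin-labels K K' π π' same (⟨B⟩ φ) (j' , le , lt , s) = j' , le , lt , satLin-labels K K' π π' same φ s
  satLin-labels K K' π π' same (⟨E⟩ φ) (i' , lt , le , s) = i' , lt , le , satLin-labels K K' π π' same φ s
  satLin-labels K K' π π' same (⟨B̄⟩ φ) (j' , lt , s) = j' , lt , satLin-labels K K' π π' same φ s
  satLin-labels K K' π π' same (⟨Ē⟩ φ) (i' , lt , s) = i' , lt , satLin-labels K K' π π' same φ s

  record Homomorphism (K K' : FinKripke AP) : Set where
    private
      module K = FinKripke K
      module K' = FinKripke K'
    field
      map-state : Fin K.m → Fin K'.m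
      map-edge : ∀ x y → T (K.δ x y) → T (K'.δ (map-state x) (map-state y))
      map-label : ∀ x q → K'.μ (map-state x) q ≡ K.μ x q
      map-root : map-state K.s₀ ≡ K'.s₀

  ⊨Lin-reflect : ∀ {K K'} → Homomorphism K K' → ∀ φ → ⊨Lin K' φ → ⊨Lin K φ
  ⊨Lin-reflect {K} {K'} f φ valid π path root i =
    satLin-labels (toKripke K') (toKripke K) (map-state ∘ π) π (λ h → map-label (π h)) φ
      (valid (map-state ∘ π) (λ h → map-edge _ _ (path h)) (trans (cong map-state root) map-root) i)
    where open Homomorphism f

  separated⇒¬≽ : ∀ {L₁ L₂ : Semantics AP} ψ →
                 (∀ φ → ∃₂ λ M N → (L₁ M φ → L₁ N φ) × L₂ M ψ × ¬ L₂ N ψ) →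
                 ¬ (L₁ ≽ L₂)
  separated⇒¬≽ ψ separated L₁≽L₂ with L₁≽L₂ ψ
  ... | φ , same with separated φ
  ...   | M , N , transfer , M⊨ψ , N⊭ψ =
    N⊭ψ (Equivalence.to (same N) (transfer (Equivalence.from (same M) M⊨ψ)))

  hom-separated⇒¬Lin≽ : ∀ {L : Semantics AP} {K K'} ψ → Homomorphism K K' → L K' ψ → ¬ L K ψ →
                        ¬ (⊨Lin ≽ L)
  hom-separated⇒¬Lin≽ {K = K} {K'} ψ f K'⊨ψ K⊭ψ =
    separated⇒¬≽ ψ (λ φ → K' , K , ⊨Lin-reflect f φ , K'⊨ψ , K⊭ψ)

-- HS_lin cannot express that p-traces are never stuck

Serial : ∀ {AP} → Kripke AP → AP → Set
Serial K p = ∀ x → Kripke.μ K x p ≡ true → ∃[ y ] Kripke.δ K x y × Kripke.μ K y p ≡ true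

CompTree-serial : ∀ {AP} (K : Kripke AP) p → Serial K p → Serial (CompTree K) p
CompTree-serial K p serial (ρ , tr , root) pρ with serial (last ρ) pρ
... | y , d , py =
  (ρ ⁺∷ʳ y , IsTrace-⁺∷ʳ K ρ tr d , trans (head-⁺∷ʳ ρ y) root) , (y , d , refl) ,
  trans (cong (λ z → Kripke.μ K z p) (last-⁺∷ʳ ρ y)) py

module _ {AP : Set} (p : AP) where

  noStuckP : HS AP
  noStuckP = ¬' ⟨B̄⟩ (atom p ∧' (¬' ⟨B̄⟩ (atom p)))

  serial⇒noStuckP : ∀ K → Serial K p → ∀ ρ → satSt K noStuckP ρ
  serial⇒noStuckP K serial ρ (σ , _ , tr , allp , unextendable) with serial _ (All-last (ρ ⁺++ σ) allp)
  ... | y , d , py =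
    unextendable (y ∷ [] , (λ ()) , IsTrace-⁺∷ʳ K (ρ ⁺++ σ) tr d ,
                  subst (All _) (sym (toList-⁺∷ʳ (ρ ⁺++ σ) y)) (All-++⁺ allp (py ∷ [])))

module _ {AP : Set} where

  alive-edge : Fin 2 → Fin 2 → Bool
  alive-edge zero _ = true
  alive-edge (suc zero) (suc zero) = true
  alive-edge _ _ = false

  alive-label : Fin 2 → AP → Bool
  alive-label zero _ = true
  alive-label (suc zero) _ = false

  Kalive : FinKripke AP
  Kalive = record { m = 2 ; δ = alive-edge ; total = total ; μ = alive-label ; s₀ = zero }
    where
    total : ∀ s → ∃[ t ] T (alive-edge s t)
    total zero = zero , tt
    total (suc zero) = suc zero , tt

  stuck-edge : Fin 3 → Fin 3 → Bool
  stuck-edge zero _ = true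
  stuck-edge (suc zero) (suc (suc zero)) = true
  stuck-edge (suc (suc zero)) (suc (suc zero)) = true
  stuck-edge _ _ = false

  stuck-label : Fin 3 → AP → Bool
  stuck-label (suc (suc zero)) _ = false
  stuck-label _ _ = true

  Kstuck : FinKripke AP
  Kstuck = record { m = 3 ; δ = stuck-edge ; total = total ; μ = stuck-label ; s₀ = zero }
    where
    total : ∀ s → ∃[ t ] T (stuck-edge s t)
    total zero = zero , tt
    total (suc zero) = suc (suc zero) , tt
    total (suc (suc zero)) = suc (suc zero) , tt

  collapse : Homomorphism Kstuck Kalive
  collapse = record { map-state = map-state ; map-edge = map-edge ; map-label = map-label ; map-root = refl }
    where
    map-state : Fin 3 → Fin 2
    map-state (suc (suc zero)) = suc zero
    map-state _ = zero

    map-edge : ∀ x y → T (stuck-edge x y) → T (alive-edge (map-state x) (map-state y))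
    map-edge zero _ _ = tt
    map-edge (suc zero) (suc (suc zero)) _ = tt
    map-edge (suc (suc zero)) (suc (suc zero)) _ = tt

    map-label : ∀ x q → alive-label (map-state x) q ≡ stuck-label x q
    map-label zero _ = refl
    map-label (suc zero) _ = refl
    map-label (suc (suc zero)) _ = refl

  alive-serial : ∀ p → Serial (toKripke Kalive) p
  alive-serial p zero _ = zero , tt , refl
  alive-serial p (suc zero) ()

  module _ (p : AP) where

    ⊨St-alive : ⊨St Kalive (noStuckP p)
    ⊨St-alive ρ _ = serial⇒noStuckP p (toKripke Kalive) (alive-serial p) ρ

    ⊨Ct-alive : ⊨Ct Kalive (noStuckP p)
    ⊨Ct-alive Λ _ = serial⇒noStuckP p (CompTree (toKripke Kalive)) (CompTree-serial _ p (alive-serial p)) Λ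

    ⊭St-stuck : ¬ ⊨St Kstuck (noStuckP p)
    ⊭St-stuck valid =
      valid (zero ∷ []) (single zero , refl)
        (suc zero ∷ [] , (λ ()) , step tt (single _) , refl ∷ refl ∷ [] , unextendable)
      where
      unextendable : ¬ satSt (toKripke Kstuck) (⟨B̄⟩ (atom p)) (zero ∷ suc zero ∷ [])
      unextendable ([] , σ≢[] , _) = σ≢[] refl
      unextendable (zero ∷ _ , _ , step _ (step () _) , _)
      unextendable (suc zero ∷ _ , _ , step _ (step () _) , _)
      unextendable (suc (suc zero) ∷ _ , _ , _ , _ ∷ _ ∷ () ∷ _)

    ⊭Ct-stuck : ¬ ⊨Ct Kstuck (noStuckP p)
    ⊭Ct-stuck valid =
      valid (root ∷ []) (single root , refl)
        (child ∷ [] , (λ ()) , step (suc zero , tt , refl) (single _) , refl ∷ refl ∷ [] , unextendable)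
      where
      root child : Kripke.S (CompTree (toKripke Kstuck))
      root = zero ∷ [] , single zero , refl
      child = zero ∷ suc zero ∷ [] , step tt (single _) , refl
      unextendable : ¬ satSt (CompTree (toKripke Kstuck)) (⟨B̄⟩ (atom p)) (root ∷ child ∷ [])
      unextendable ([] , σ≢[] , _) = σ≢[] refl
      unextendable (_ ∷ _ , _ , step _ (step (zero , () , _) _) , _)
      unextendable (_ ∷ _ , _ , step _ (step (suc zero , () , _) _) , _)
      unextendable (_ ∷ _ , _ , step _ (step (suc (suc zero) , _ , refl) _) , _ ∷ _ ∷ () ∷ _)

    ¬Lin≽St : ¬ (⊨Lin ≽ ⊨St)
    ¬Lin≽St = hom-separated⇒¬Lin≽ (noStuckP p) collapse ⊨St-alive ⊭St-stuck

    ¬Lin≽Ct : ¬ (⊨Lin ≽ ⊨Ct)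
    ¬Lin≽Ct = hom-separated⇒¬Lin≽ (noStuckP p) collapse ⊨Ct-alive ⊭Ct-stuck

-- The ladder

data Step (L : ℕ) : ℕ → ℕ → Set where
  descend : ∀ {n} → Step L (suc n) n
  rest-bottom : Step L 0 0
  rest-top : Step L (suc L) (suc L)

step? : ∀ L m n → Dec (Step L m n)
step? L zero zero = yes rest-bottom
step? L zero (suc n) = no λ ()
step? L (suc m) n with m ≟ n
... | yes refl = yes descend
... | no m≢n with m ≟ L | n ≟ suc L
...   | yes refl | yes refl = yes rest-top
...   | yes refl | no n≢1+L = no λ { descend → m≢n refl ; rest-top → n≢1+L refl }
...   | no m≢L | _ = no λ { descend → m≢n refl ; rest-top → m≢L refl }

Step-≤ : ∀ {L m n} → Step L m n → n ≤ m
Step-≤ descend = n≤1+n _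
Step-≤ rest-bottom = z≤n
Step-≤ rest-top = ≤-refl

Step-≤suc : ∀ {L m n} → Step L m n → m ≤ suc n
Step-≤suc descend = ≤-refl
Step-≤suc rest-bottom = z≤n
Step-≤suc rest-top = n≤1+n _

positive : ℕ → Bool
positive zero = false
positive (suc _) = true

module Ladder (L : ℕ) {AP : Set} where

  State : Set
  State = Fin (suc (suc L))

  edge : State → State → Bool
  edge x y = isYes (step? L (toℕ x) (toℕ y))

  Step-edge : ∀ {x y} → Step L (toℕ x) (toℕ y) → T (edge x y)
  Step-edge {x} {y} = fromWitness {a? = step? L (toℕ x) (toℕ y)}

  ladder : State → FinKripke AP
  ladder r = record { m = suc (suc L) ; δ = edge ; total = total ; μ = λ x _ → positive (toℕ x) ; s₀ = r }
    where
    total : ∀ x → ∃[ y ] T (edge x y)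
    total zero = zero , Step-edge rest-bottom
    total (suc x) = inject₁ x , Step-edge (subst (Step L (suc (toℕ x))) (sym (toℕ-inject₁ x)) descend)

  -- Paths do not depend on the root; they are taken in the copy rooted at 0.
  Ladder : Kripke AP
  Ladder = toKripke (ladder zero)

  Path : List State → Set
  Path = IsPath Ladder

  edge-Step : ∀ {x y} → T (edge x y) → Step L (toℕ x) (toℕ y)
  edge-Step = toWitness

  open FarLists {State} toℕ public

  AllFar-label : ∀ {t xs} p → AllFar t xs → All (λ x → Kripke.μ Ladder x p ≡ true) xs
  AllFar-label p = All.map far-positive
    where
    far-positive : ∀ {t x} → Far t x → positive (toℕ x) ≡ true
    far-positive {x = x} far with toℕ x
    ... | suc _ = refl

  Far-backwards : ∀ {t} σ {x rest} → Path (σ ++ x ∷ rest) → Far t x → AllFar t σ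
  Far-backwards [] _ _ = []
  Far-backwards (s ∷ []) (step d _) far = <-≤-trans far (Step-≤ (edge-Step d)) ∷ []
  Far-backwards (s ∷ s' ∷ σ) (step d p) far with Far-backwards (s' ∷ σ) p far
  ... | f ∷ fs = <-≤-trans f (Step-≤ (edge-Step d)) ∷ f ∷ fs

  drop-bound : ∀ x xs y {ys} → Path (x ∷ xs ++ y ∷ ys) → toℕ x ≤ suc (length xs + toℕ y)
  drop-bound x [] y (step d _) = Step-≤suc (edge-Step d)
  drop-bound x (z ∷ zs) y (step d p) = ≤-trans (Step-≤suc (edge-Step d)) (s≤s (drop-bound z zs y p))

  first-near : ∀ {t} xs {y ys} → xs ≢ [] → AllFar t xs → Path (xs ++ y ∷ ys) → toℕ y ≤ t →
               toℕ y ≡ t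
  first-near [] xs≢[] _ _ _ = ⊥-elim (xs≢[] refl)
  first-near (x ∷ []) _ (far ∷ []) (step d _) y≤t =
    ≤-antisym y≤t (≤-pred (<-≤-trans far (Step-≤suc (edge-Step d))))
  first-near (x ∷ x' ∷ xs) _ (_ ∷ fars) (step _ p) y≤t = first-near (x' ∷ xs) (λ ()) fars p y≤t

  toℕ≤1+L : ∀ x → toℕ x ≤ suc L
  toℕ≤1+L x = ≤-pred (toℕ<n x)

  level : ℕ → State
  level n with n ≤? suc L
  ... | yes n≤ = fromℕ< (s≤s n≤)
  ... | no _ = fromℕ (suc L)

  toℕ-level : ∀ n → toℕ (level n) ≡ n ⊓ suc L
  toℕ-level n with n ≤? suc L
  ... | yes n≤ = trans (toℕ-fromℕ< (s≤s n≤)) (sym (m≤n⇒m⊓n≡m n≤))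
  ... | no n≰ = trans (toℕ-fromℕ (suc L)) (sym (m≥n⇒m⊓n≡n (<⇒≤ (≰⇒> n≰))))

  toℕ-level-≤ : ∀ {n} → n ≤ suc L → toℕ (level n) ≡ n
  toℕ-level-≤ {n} n≤ = trans (toℕ-level n) (m≤n⇒m⊓n≡m n≤)

  level-toℕ : ∀ x → level (toℕ x) ≡ x
  level-toℕ x = toℕ-injective (toℕ-level-≤ (toℕ≤1+L x))

  level-edge : ∀ n → T (edge (level (suc n)) (level n))
  level-edge n = Step-edge (subst₂ (Step L) (sym (toℕ-level (suc n))) (sym (toℕ-level n)) (Step-⊓ n))
    where
    Step-⊓ : ∀ n → Step L (suc n ⊓ suc L) (n ⊓ suc L)
    Step-⊓ n with n ≤? L
    ... | yes n≤L rewrite m≤n⇒m⊓n≡m n≤L | m≤n⇒m⊓n≡m (m≤n⇒m≤1+n n≤L) = descend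
    ... | no n≰L rewrite m≥n⇒m⊓n≡n (≰⇒> n≰L) | m≥n⇒m⊓n≡n (<⇒≤ (≰⇒> n≰L)) = rest-top

  stairs : ℕ → ℕ → List State
  stairs a zero = []
  stairs a (suc k) = level (suc (a + k)) ∷ stairs a k

  length-stairs : ∀ a k → length (stairs a k) ≡ k
  length-stairs a zero = refl
  length-stairs a (suc k) = cong suc (length-stairs a k)

  stairs-far : ∀ {t} a k → t ≤ a → t < suc L → AllFar t (stairs a k)
  stairs-far a zero _ _ = []
  stairs-far {t} a (suc k) t≤a t<L = far ∷ stairs-far a k t≤a t<L
    where
    far : t < toℕ (level (suc (a + k)))
    far rewrite toℕ-level (suc (a + k)) = ⊓-glb (s≤s (≤-trans t≤a (m≤m+n a k))) t<L

  stairs-path : ∀ a k {rest} → Path (level a ∷ rest) → Path (stairs a k ++ level a ∷ rest)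
  stairs-path a zero p = p
  stairs-path a (suc zero) p =
    step (subst (λ n → T (edge (level (suc n)) (level a))) (sym (+-identityʳ a)) (level-edge a)) p
  stairs-path a (suc (suc k)) p =
    step (subst (λ n → T (edge (level (suc n)) (level (suc (a + k))))) (sym (+-suc a k)) (level-edge (suc (a + k))))
         (stairs-path a (suc k) p)

  -- σ' descends from y as long as σ runs, but for at most t steps.
  follow-far : ∀ {t} y σ → t + t < toℕ y → AllFar t σ → ∃[ σ' ] Path (y ∷ σ') × FarTwins t σ σ'
  follow-far {t} y σ 2t<y σ-far = stairs a m , path , farTwins σ-far (stairs-far a m t≤a t<1+L) length≈
    where
    m = length σ ⊓ t
    a = toℕ y ∸ suc m
    m≤t : m ≤ t
    m≤t = m⊓n≤n (length σ) t
    y≡ : suc (a + m) ≡ toℕ y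
    y≡ = trans (sym (+-suc a m)) (m∸n+n≡m (≤-trans (s≤s m≤t) (≤-trans (s≤s (m≤m+n t t)) 2t<y)))
    t≤a : t ≤ a
    t≤a = t+t≤a+b⇒a≤t⇒t≤b (subst (t + t ≤_) (+-comm a m) (≤-pred (subst (t + t <_) (sym y≡) 2t<y)))
                          m≤t
    t<1+L : t < suc L
    t<1+L = <-≤-trans (≤-<-trans (m≤m+n t t) 2t<y) (toℕ≤1+L y)
    path : Path (y ∷ stairs a m)
    path = subst (λ z → Path (z ∷ stairs a m)) (trans (cong level y≡) (level-toℕ y))
             (IsPath-++⁻ˡ Ladder (stairs a (suc m)) (stairs-path a (suc m) (single (level a))))
    length≈ : length σ ≈[ t ] length (stairs a m)
    length≈ = subst (length σ ≈[ t ]_) (sym (length-stairs a m)) (≈-sym (⊓-≈ (length σ) t))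

  -- Where σ first drops to t it is exactly at t, so σ' descends from y to t and then follows σ.
  follow-near : ∀ {t} x y s z zs → t + t < toℕ x → t + t < toℕ y → AllFar t s → toℕ z ≤ t →
                Path (x ∷ s ++ z ∷ zs) → ∃[ σ' ] Path (y ∷ σ') × FarVariant t (s ++ z ∷ zs) σ'
  follow-near {t} x y s z zs 2t<x 2t<y s-far z≤t p =
    stairs t m' ++ z ∷ zs , path ,
    farVariant (farTwins s-far (stairs-far t m' ≤-refl t<1+L)
                         (inj₂ (t≤∣s∣ , subst (t ≤_) (sym (length-stairs t m')) t≤m')))
               (z ∷ zs)
    where
    m' = toℕ y ∸ suc t
    y≡ : suc (t + m') ≡ toℕ y
    y≡ = m+[n∸m]≡n (≤-<-trans (m≤m+n t t) 2t<y)
    t<1+L : t < suc L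
    t<1+L = <-≤-trans (≤-<-trans (m≤m+n t t) 2t<y) (toℕ≤1+L y)
    z≡t : toℕ z ≡ t
    z≡t = first-near (x ∷ s) (λ ()) (≤-<-trans (m≤m+n t t) 2t<x ∷ s-far) p z≤t
    z-path : Path (level t ∷ zs)
    z-path = subst (λ w → Path (w ∷ zs)) (trans (sym (level-toℕ z)) (cong level z≡t))
                   (IsPath-++⁻ʳ Ladder (x ∷ s) p)
    path : Path (y ∷ stairs t m' ++ z ∷ zs)
    path = subst₂ (λ v w → Path (v ∷ stairs t m' ++ w ∷ zs))
             (trans (cong level y≡) (level-toℕ y)) (trans (cong level (sym z≡t)) (level-toℕ z))
             (stairs-path t (suc m') z-path)
    t≤∣s∣ : t ≤ length s
    t≤∣s∣ = +-cancelʳ-≤ t t (length s)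
              (≤-pred (≤-trans 2t<x (subst (λ v → toℕ x ≤ suc (length s + v)) z≡t (drop-bound x s z p))))
    t≤m' : t ≤ m'
    t≤m' = +-cancelˡ-≤ t t m' (≤-pred (subst (t + t <_) (sym y≡) 2t<y))

  follow : ∀ {t} x y σ → t + t < toℕ x → t + t < toℕ y → Path (x ∷ σ) →
           ∃[ σ' ] Path (y ∷ σ') × FarVariant t σ σ'
  follow {t} x y σ 2t<x 2t<y p with span-Far t σ
  ... | inj₁ σ-far = let σ' , q , tw = follow-far y σ 2t<y σ-far in σ' , q , FarTwins⇒FarVariant tw
  ... | inj₂ (s , z , zs , refl , s-far , z≤t) =
    follow-near x y s z zs 2t<x 2t<y s-far z≤t p

  last-far : ∀ {t} bs {x} → AllFar t (bs ∷ʳ x) → Far t x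
  last-far bs fars with All-++⁻ʳ bs fars
  ... | far ∷ [] = far

  FarTwins-extend : ∀ {t β β' σ} → 1 ≤ t → FarTwins (t + t) β β' → σ ≢ [] →
                    Path (β ++ σ) → Path β' →
                    ∃[ σ' ] σ' ≢ [] × Path (β' ++ σ') × FarVariant t (β ++ σ) (β' ++ σ')
  FarTwins-extend {t} {β} {β'} {σ} 1≤t tw σ≢[] p p' with initLast β | initLast β'
  ... | [] | [] = σ , σ≢[] , p , FarVariant-refl
  ... | [] | _ ∷ʳ′ _ =
    ⊥-elim (FarTwins-nonempty (≤-trans 1≤t (m≤m+n t t)) (FarTwins-sym tw) (++-∷-nonempty _) refl)
  ... | _ ∷ʳ′ _ | [] = ⊥-elim (FarTwins-nonempty (≤-trans 1≤t (m≤m+n t t)) tw (++-∷-nonempty _) refl)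
  ... | bs ∷ʳ′ x | bs' ∷ʳ′ y
    with follow x y σ (last-far bs (FarTwins.far₁ tw)) (last-far bs' (FarTwins.far₂ tw))
                (IsPath-++⁻ʳ Ladder bs (subst Path (++-assoc bs (x ∷ []) σ) p))
  ...   | σ' , q , v =
    σ' , FarVariant-nonempty 1≤t v σ≢[] ,
    subst Path (sym (++-assoc bs' (y ∷ []) σ')) (IsPath-glue Ladder bs' (y ∷ []) (λ ()) p' q) ,
    FarTwins-++-FarVariant (FarTwins-weaken (m≤m+n t t) tw) v

  FarVariant-extend : ∀ {t β β' σ} → 1 ≤ t → FarVariant (t + t) β β' → σ ≢ [] →
                      Path (β ++ σ) → Path β' →
                      ∃[ σ' ] σ' ≢ [] × Path (β' ++ σ') × FarVariant t (β ++ σ) (β' ++ σ')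
  FarVariant-extend 1≤t (farVariant {b} {b'} tw []) σ≢[] p p'
    rewrite ++-identityʳ b | ++-identityʳ b' = FarTwins-extend 1≤t tw σ≢[] p p'
  FarVariant-extend {t} {σ = σ} 1≤t (farVariant {b} {b'} tw (w ∷ ws)) σ≢[] p p' =
    σ , σ≢[] ,
    subst Path (sym (++-assoc b' (w ∷ ws) σ))
      (IsPath-glue Ladder b' (w ∷ ws) (λ ()) p'
        (IsPath-++⁻ʳ Ladder b (subst Path (++-assoc b (w ∷ ws) σ) p))) ,
    FarVariant-++ʳ σ (farVariant (FarTwins-weaken (m≤m+n t t) tw) (w ∷ ws))

  FarVariant-prepend : ∀ {t β β' σ} → 1 ≤ t → FarVariant (t + t) β β' → σ ≢ [] →
                       Path (σ ++ β) → Path β' →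
                       ∃[ σ' ] σ' ≢ [] × Path (σ' ++ β') × FarVariant t (σ ++ β) (σ' ++ β')
  FarVariant-prepend {σ = σ} _ (farVariant {[]} {[]} _ _) σ≢[] p _ = σ , σ≢[] , p , FarVariant-refl
  FarVariant-prepend {t} 1≤t (farVariant {[]} {_ ∷ _} tw _) _ _ _ =
    ⊥-elim (FarTwins-nonempty (≤-trans 1≤t (m≤m+n t t)) (FarTwins-sym tw) (λ ()) refl)
  FarVariant-prepend {t} 1≤t (farVariant {_ ∷ _} {[]} tw _) _ _ _ =
    ⊥-elim (FarTwins-nonempty (≤-trans 1≤t (m≤m+n t t)) tw (λ ()) refl)
  FarVariant-prepend {t} {σ = σ} 1≤t (farVariant {x ∷ bs} {x' ∷ bs'} tw W) σ≢[] p p' =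
    σ' , σ'≢[] ,
    subst (λ v → Path (σ' ++ v ∷ bs' ++ W)) (level-toℕ x')
      (stairs-path (toℕ x') (length σ) (subst (λ v → Path (v ∷ bs' ++ W)) (sym (level-toℕ x')) p')) ,
    subst₂ (FarVariant t) (++-assoc σ (x ∷ bs) W) (++-assoc σ' (x' ∷ bs') W)
      (farVariant (FarTwins-++ σ-twins (FarTwins-weaken (m≤m+n t t) tw)) W)
    where
    σ' = stairs (toℕ x') (length σ)
    σ'≢[] : σ' ≢ []
    σ'≢[] σ'≡[] =
      σ≢[] (length≡0⇒[] (trans (sym (length-stairs (toℕ x') (length σ))) (cong length σ'≡[])))
    x'-far : t + t < toℕ x'
    x'-far with FarTwins.far₂ tw
    ... | far ∷ _ = far
    σ-twins : FarTwins t σ σ'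
    σ-twins = farTwins
      (AllFar-weaken (m≤m+n t t) (Far-backwards σ p (All.head (FarTwins.far₁ tw))))
      (stairs-far (toℕ x') (length σ) (≤-trans (m≤m+n t t) (<⇒≤ x'-far))
                  (<-≤-trans (≤-<-trans (m≤m+n t t) x'-far) (toℕ≤1+L x')))
      (inj₁ (sym (length-stairs (toℕ x') (length σ))))

  FarVariant-labelled : ∀ {t β β'} p → FarVariant t β β' → Labelled Ladder p β → Labelled Ladder p β'
  FarVariant-labelled p (farVariant {b} tw W) labelled =
    All-++⁺ (AllFar-label p (FarTwins.far₂ tw)) (All-++⁻ʳ b labelled)

  TraceRel : ℕ → List State → List State → Set
  TraceRel t β β' = FarVariant t β β' × Path β × Path β'

  module _ where
    open IntervalSystem (traceSystem Ladder)

    TraceRel-zigB : Zig (traceSystem Ladder) TraceRel _⟶B_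
    TraceRel-zigB 1≤t (v , p , p') (γ≢[] , σ , σ≢[] , β≡) with FarVariant-split′ v β≡
    ... | γ' , σ' , β'≡ , vγ , vσ =
      γ' , (FarVariant-nonempty 1≤t vγ γ≢[] , σ' , FarVariant-nonempty 1≤t vσ σ≢[] , β'≡) ,
      vγ , IsPath-++⁻ˡ Ladder _ (subst Path β≡ p) , IsPath-++⁻ˡ Ladder γ' (subst Path β'≡ p')

    TraceRel-zigE : Zig (traceSystem Ladder) TraceRel _⟶E_
    TraceRel-zigE 1≤t (v , p , p') (γ≢[] , σ , σ≢[] , β≡) with FarVariant-split′ v β≡
    ... | σ' , γ' , β'≡ , vσ , vγ =
      γ' , (FarVariant-nonempty 1≤t vγ γ≢[] , σ' , FarVariant-nonempty 1≤t vσ σ≢[] , β'≡) ,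
      vγ , IsPath-++⁻ʳ Ladder σ (subst Path β≡ p) , IsPath-++⁻ʳ Ladder σ' (subst Path β'≡ p')

    TraceRel-zigB̄ : Zig (traceSystem Ladder) TraceRel _⟶B̄_
    TraceRel-zigB̄ {i' = β'} 1≤t (v , p , p') (q , σ , σ≢[] , refl) with FarVariant-extend 1≤t v σ≢[] q p'
    ... | σ' , σ'≢[] , q' , v' = β' ++ σ' , (q' , σ' , σ'≢[] , refl) , v' , q , q'

    TraceRel-zigĒ : Zig (traceSystem Ladder) TraceRel _⟶Ē_
    TraceRel-zigĒ {i' = β'} 1≤t (v , p , p') (q , σ , σ≢[] , refl) with FarVariant-prepend 1≤t v σ≢[] q p'
    ... | σ' , σ'≢[] , q' , v' = σ' ++ β' , (q' , σ' , σ'≢[] , refl) , v' , q , q'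

  TraceRel-bf : IsBackAndForth (traceSystem Ladder) TraceRel
  TraceRel-bf = record
    { symmetric = λ (v , p , p') → FarVariant-sym v , p' , p
    ; weaken = λ t'≤t (v , p , p') → FarVariant-weaken t'≤t v , p , p'
    ; holds-resp = λ p _ (v , _) → FarVariant-labelled p v
    ; zigB = TraceRel-zigB
    ; zigE = TraceRel-zigE
    ; zigB̄ = TraceRel-zigB̄
    ; zigĒ = TraceRel-zigĒ
    }

  data PairVariant (t : ℕ) : List State × List State → List State × List State → Set where
    far-split : ∀ {A A' B B'} → FarTwins t A A' → FarVariant t B B' → PairVariant t (A , B) (A' , B')
    common-split : ∀ {A A' B} → FarVariant t A A' → PairVariant t (A , B) (A' , B)

  PairVariant-sym : ∀ {t P P'} → PairVariant t P P' → PairVariant t P' P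
  PairVariant-sym (far-split tw v) = far-split (FarTwins-sym tw) (FarVariant-sym v)
  PairVariant-sym (common-split v) = common-split (FarVariant-sym v)

  PairVariant-weaken : ∀ {t t' P P'} → t' ≤ t → PairVariant t P P' → PairVariant t' P P'
  PairVariant-weaken t'≤t (far-split tw v) = far-split (FarTwins-weaken t'≤t tw) (FarVariant-weaken t'≤t v)
  PairVariant-weaken t'≤t (common-split v) = common-split (FarVariant-weaken t'≤t v)

  PairRel : ℕ → List State × List State → List State × List State → Set
  PairRel t (A , B) (A' , B') =
    PairVariant t (A , B) (A' , B') × B ≢ [] × B' ≢ [] × Path (A ++ B) × Path (A' ++ B')

  module _ where
    open IntervalSystem (pairSystem Ladder)

    PairRel-symmetric : ∀ {t P P'} → PairRel t P P' → PairRel t P' P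
    PairRel-symmetric {P = _ , _} {_ , _} (pv , B≢[] , B'≢[] , p , p') = PairVariant-sym pv , B'≢[] , B≢[] , p' , p

    PairRel-holds : ∀ {t P P'} q → 1 ≤ t → PairRel t P P' → holds q P → holds q P'
    PairRel-holds {P = _ , _} {_ , _} q _ (far-split _ v , _) = FarVariant-labelled q v
    PairRel-holds {P = _ , _} {_ , _} q _ (common-split _ , _) labelled = labelled

    Path-prefix : ∀ A {B B₁ σ} → B ≡ B₁ ++ σ → Path (A ++ B) → Path (A ++ B₁)
    Path-prefix A {B₁ = B₁} {σ} refl p =
      IsPath-++⁻ˡ Ladder (A ++ B₁) (subst Path (sym (++-assoc A B₁ σ)) p)

    Path-regroup : ∀ A {B σ B₁} → B ≡ σ ++ B₁ → Path (A ++ B) → Path ((A ++ σ) ++ B₁)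
    Path-regroup A {σ = σ} {B₁} refl = subst Path (sym (++-assoc A σ B₁))

    Path-ungroup : ∀ {A} A₁ α B → A ≡ A₁ ++ α → Path (A ++ B) → Path (A₁ ++ α ++ B)
    Path-ungroup A₁ α B refl = subst Path (++-assoc A₁ α B)

    PairRel-zigB : Zig (pairSystem Ladder) PairRel _⟶B_
    PairRel-zigB {i = A , B} {A' , B'} 1≤t (far-split tw v , _ , _ , p , p') (refl , B₁≢[] , σ , σ≢[] , B≡)
      with FarVariant-split′ v B≡
    ... | B₁' , σ' , B'≡ , v₁ , vσ =
      (A' , B₁') , (refl , B₁'≢[] , σ' , FarVariant-nonempty 1≤t vσ σ≢[] , B'≡) ,
      far-split (FarTwins-weaken (m≤m+n _ _) tw) v₁ , B₁≢[] , B₁'≢[] ,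
      Path-prefix A B≡ p , Path-prefix A' B'≡ p'
      where
      B₁'≢[] = FarVariant-nonempty 1≤t v₁ B₁≢[]
    PairRel-zigB {i = A , B} {A' , .B} 1≤t (common-split v , _ , _ , p , p') (refl , B₁≢[] , σ , σ≢[] , B≡) =
      (A' , _) , (refl , B₁≢[] , σ , σ≢[] , B≡) ,
      common-split (FarVariant-weaken (m≤m+n _ _) v) , B₁≢[] , B₁≢[] ,
      Path-prefix A B≡ p , Path-prefix A' B≡ p'

    PairRel-zigE : Zig (pairSystem Ladder) PairRel _⟶E_
    PairRel-zigE {i = A , B} {A' , B'} 1≤t (far-split tw v , _ , _ , p , p') (B₁≢[] , σ , σ≢[] , B≡ , refl)
      with FarVariant-split v B≡
    ... | σ' , B₁' , B'≡ , inj₁ (twσ , v₁) =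
      (A' ++ σ' , B₁') , (B₁'≢[] , σ' , FarTwins-nonempty 1≤t twσ σ≢[] , B'≡ , refl) ,
      far-split (FarTwins-++ (FarTwins-weaken (m≤m+n _ _) tw) twσ) v₁ , B₁≢[] , B₁'≢[] ,
      Path-regroup A B≡ p , Path-regroup A' B'≡ p'
      where
      B₁'≢[] = FarVariant-nonempty 1≤t v₁ B₁≢[]
    ... | σ' , B₁' , B'≡ , inj₂ (refl , vσ) =
      (A' ++ σ' , B₁') , (B₁≢[] , σ' , FarVariant-nonempty 1≤t vσ σ≢[] , B'≡ , refl) ,
      common-split (FarTwins-++-FarVariant (FarTwins-weaken (m≤m+n _ _) tw) vσ) , B₁≢[] , B₁≢[] ,
      Path-regroup A B≡ p , Path-regroup A' B'≡ p'
    PairRel-zigE {i = A , B} {A' , .B} 1≤t (common-split v , _ , _ , p , p') (B₁≢[] , σ , σ≢[] , B≡ , refl) =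
      (A' ++ σ , _) , (B₁≢[] , σ , σ≢[] , B≡ , refl) ,
      common-split (FarVariant-++ʳ σ (FarVariant-weaken (m≤m+n _ _) v)) , B₁≢[] , B₁≢[] ,
      Path-regroup A B≡ p , Path-regroup A' B≡ p'

    PairRel-zigB̄ : Zig (pairSystem Ladder) PairRel _⟶B̄_
    PairRel-zigB̄ {i = A , B} {A' , B'} 1≤t (far-split tw v , B≢[] , B'≢[] , p , p') (refl , q , σ , σ≢[] , refl)
      with FarVariant-extend 1≤t v σ≢[] (IsPath-++⁻ʳ Ladder A q) (IsPath-++⁻ʳ Ladder A' p')
    ... | σ' , σ'≢[] , q' , v' =
      (A' , B' ++ σ') , (refl , glued , σ' , σ'≢[] , refl) ,
      far-split (FarTwins-weaken (m≤m+n _ _) tw) v' , ++-nonemptyˡ σ B≢[] , ++-nonemptyˡ σ' B'≢[] , q , glued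
      where
      glued : Path (A' ++ B' ++ σ')
      glued = IsPath-glue Ladder A' B' B'≢[] p' q'
    PairRel-zigB̄ {i = A , B} {A' , .B} 1≤t (common-split v , B≢[] , _ , p , p') (refl , q , σ , σ≢[] , refl) =
      (A' , B ++ σ) , (refl , glued , σ , σ≢[] , refl) ,
      common-split (FarVariant-weaken (m≤m+n _ _) v) , ++-nonemptyˡ σ B≢[] , ++-nonemptyˡ σ B≢[] , q , glued
      where
      glued : Path (A' ++ B ++ σ)
      glued = IsPath-glue Ladder A' B B≢[] p' (IsPath-++⁻ʳ Ladder A q)

    PairRel-zigĒ : Zig (pairSystem Ladder) PairRel _⟶Ē_
    PairRel-zigĒ {i = A , B} {A' , B'} {A₁ , _} 1≤t (far-split tw v , _ , _ , p , p') (α , α≢[] , A≡ , refl)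
      with FarTwins-split tw A≡
    ... | A₁' , α' , A'≡ , tw₁ , twα =
      (A₁' , α' ++ B') , (α' , α'≢[] , A'≡ , refl) ,
      far-split tw₁ (FarTwins-++-FarVariant twα (FarVariant-weaken (m≤m+n _ _) v)) ,
      ++-nonemptyˡ B α≢[] , ++-nonemptyˡ B' α'≢[] , Path-ungroup A₁ α B A≡ p , Path-ungroup A₁' α' B' A'≡ p'
      where
      α'≢[] = FarTwins-nonempty 1≤t twα α≢[]
    PairRel-zigĒ {i = A , B} {A' , .B} {A₁ , _} 1≤t (common-split v , _ , _ , p , p') (α , α≢[] , A≡ , refl)
      with FarVariant-split v A≡
    ... | A₁' , α' , A'≡ , inj₁ (tw₁ , vα) =
      (A₁' , α' ++ B) , (α' , α'≢[] , A'≡ , refl) ,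
      far-split tw₁ (FarVariant-++ʳ B vα) , ++-nonemptyˡ B α≢[] , ++-nonemptyˡ B α'≢[] ,
      Path-ungroup A₁ α B A≡ p , Path-ungroup A₁' α' B A'≡ p'
      where
      α'≢[] = FarVariant-nonempty 1≤t vα α≢[]
    ... | A₁' , α' , A'≡ , inj₂ (refl , v₁) =
      (A₁' , α ++ B) , (α , α≢[] , A'≡ , refl) ,
      common-split v₁ , ++-nonemptyˡ B α≢[] , ++-nonemptyˡ B α≢[] ,
      Path-ungroup A₁ α B A≡ p , Path-ungroup A₁' α B A'≡ p'

  PairRel-bf : IsBackAndForth (pairSystem Ladder) PairRel
  PairRel-bf = record
    { symmetric = PairRel-symmetric
    ; weaken = λ { t'≤t (pv , rest) → PairVariant-weaken t'≤t pv , rest }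
    ; holds-resp = PairRel-holds
    ; zigB = PairRel-zigB
    ; zigE = PairRel-zigE
    ; zigB̄ = PairRel-zigB̄
    ; zigĒ = PairRel-zigĒ
    }

  Step-count : ∀ {v v' h n} → Step L v v' → v + h ≡ n → suc h ≤ n → n ≤ L → v' + suc h ≡ n
  Step-count {v' = v'} {h} descend v+h≡n _ _ = trans (+-suc v' h) v+h≡n
  Step-count rest-bottom refl 1+h≤h _ = ⊥-elim (<-irrefl refl 1+h≤h)
  Step-count {h = h} rest-top refl _ 1+L+h≤L = ⊥-elim (<-irrefl refl (≤-trans (s≤s (m≤m+n L h)) 1+L+h≤L))

  descent-forced : ∀ (π : ℕ → State) → (∀ i → T (edge (π i) (π (suc i)))) → toℕ (π 0) ≤ L →
                   ∀ h → h ≤ toℕ (π 0) → toℕ (π h) + h ≡ toℕ (π 0)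
  descent-forced π path _ zero _ = +-identityʳ _
  descent-forced π path π0≤L (suc h) 1+h≤ =
    Step-count (edge-Step {π h} {π (suc h)} (path h))
               (descent-forced π path π0≤L h (≤-trans (n≤1+n h) 1+h≤)) 1+h≤ π0≤L

  low-root⇒⊨Lin : ∀ {r} p → toℕ r ≤ L → ⊨Lin (ladder r) (⟨B̄⟩ (¬' atom p))
  low-root⇒⊨Lin {r} p r≤L π path refl i =
    suc (i + toℕ r) , s≤s (m≤m+n i (toℕ r)) , λ all-p → false≢true (all-p (toℕ r) z≤n r≤j)
    where
    r≤j : toℕ r ≤ suc (i + toℕ r)
    r≤j = ≤-trans (m≤n+m (toℕ r) i) (n≤1+n _)
    at-bottom : toℕ (π (toℕ r)) ≡ 0
    at-bottom = +-cancelʳ-≡ (toℕ r) (toℕ (π (toℕ r))) 0 (descent-forced π path r≤L (toℕ r) ≤-refl)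
    false≢true : positive (toℕ (π (toℕ r))) ≢ true
    false≢true rewrite at-bottom = λ ()

  top-root⇒⊭Lin : ∀ p → ¬ ⊨Lin (ladder (level (suc L))) (⟨B̄⟩ (¬' atom p))
  top-root⇒⊭Lin p valid with valid (λ _ → level (suc L)) (λ _ → level-edge-top) refl 0
    where
    level-edge-top : T (edge (level (suc L)) (level (suc L)))
    level-edge-top = Step-edge (subst₂ (Step L) (sym top≡) (sym top≡) rest-top)
      where top≡ = toℕ-level-≤ (≤-refl {suc L})
  ... | _ , _ , not-all = not-all (λ _ _ _ → top-positive)
    where
    top-positive : positive (toℕ (level (suc L))) ≡ true
    top-positive rewrite toℕ-level-≤ (≤-refl {suc L}) = refl

  initial-match : ∀ {t} x y rest → t + t < toℕ x → t + t < toℕ y → Path (x ∷ rest) →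
                  ∃[ σ ] Path (y ∷ σ) × FarVariant t (y ∷ σ) (x ∷ rest)
  initial-match {t} x y rest 2t<x 2t<y p with follow x y rest 2t<x 2t<y p
  ... | σ , q , v =
    σ , q , FarVariant-sym (FarTwins-++-FarVariant (farTwins (far 2t<x ∷ []) (far 2t<y ∷ []) ≈-refl) v)
    where
    far : ∀ {z} → t + t < toℕ z → Far t z
    far = ≤-<-trans (m≤m+n t t)

  module _ (φ : HS AP) {r r' : State} where
    private
      t : ℕ
      t = 2 ^ depth φ
      module C = CompTreeTraces (toKripke (ladder r))
      module C' = CompTreeTraces (toKripke (ladder r'))

    ⊨St-transfer : t + t < toℕ r → t + t < toℕ r' → ⊨St (ladder r) φ → ⊨St (ladder r') φ
    ⊨St-transfer 2t<r 2t<r' valid (_ ∷ rest) (p' , refl)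
      with initial-match r' r rest 2t<r' 2t<r (IsPath-reroot _ p')
    ... | σ , q , v =
      Sat⇒satSt (toKripke (ladder r')) φ (r' ∷ rest) (Sat-trace-reroot Ladder r' φ
        (Sat-resp (traceSystem Ladder) TraceRel-bf φ ≤-refl (v , q , IsPath-reroot _ p')
          (Sat-trace-reroot (toKripke (ladder r)) zero φ
            (satSt⇒Sat (toKripke (ladder r)) φ (r ∷ σ) (valid (r ∷ σ) (IsPath-reroot Ladder q , refl))))))

    ⊨Ct-transfer : t + t < toℕ r → t + t < toℕ r' → ⊨Ct (ladder r) φ → ⊨Ct (ladder r') φ
    ⊨Ct-transfer 2t<r 2t<r' valid (_ ∷ us') (p' , refl)
      with IsPath-reroot _ (C'.CPath-trail _ us' p')
    ... | trail' with initial-match r' r (map C'.tip us') 2t<r' 2t<r trail'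
    ...   | σ , q , v =
      C'.Sat⇒satCt φ (_ ∷ us') p' (Sat-pair-reroot Ladder r' φ
        (Sat-resp (pairSystem Ladder) PairRel-bf φ ≤-refl (far-split FarTwins-[] v , (λ ()) , (λ ()) , q , trail')
          (Sat-pair-reroot (toKripke (ladder r)) zero φ
            (subst (Sat (pairSystem (toKripke (ladder r))) φ) projected
              (C.satCt⇒Sat φ Λ path (valid Λ (path , refl)))))))
      where
      root : C.Node
      root = r ∷ [] , single r , refl
      q' : IsPath (toKripke (ladder r)) (r ∷ σ)
      q' = IsPath-reroot Ladder q
      Λ : List⁺ C.Node
      Λ = root ∷ C.grow root σ q'
      path : C.CPath (toList Λ)
      path = C.grow-path root σ q'
      projected : C.project Λ ≡ ([] , r ∷ σ)
      projected = cong (λ xs → [] , r ∷ xs) (C.grow-tips root σ q')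

-- HS_st and HS_ct cannot express that p is eventually left

module _ {AP : Set} (p : AP) where

  reachesNotP : HS AP
  reachesNotP = ⟨B̄⟩ (¬' atom p)

  module _ (φ : HS AP) where
    private
      t L : ℕ
      t = 2 ^ depth φ
      L = suc (t + t)
      open Ladder L {AP}

      low high : FinKripke AP
      low = ladder (level L)
      high = ladder (level (suc L))

      low-value : toℕ (level L) ≡ L
      low-value = toℕ-level-≤ (n≤1+n L)

      high-value : toℕ (level (suc L)) ≡ suc L
      high-value = toℕ-level-≤ ≤-refl

      2t<low : t + t < toℕ (level L)
      2t<low = subst (t + t <_) (sym low-value) ≤-refl

      2t<high : t + t < toℕ (level (suc L))
      2t<high = subst (t + t <_) (sym high-value) (n≤1+n L)

    St-separation : ∃₂ λ M N → (⊨St M φ → ⊨St N φ) × ⊨Lin M reachesNotP × ¬ ⊨Lin N reachesNotP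
    St-separation = low , high , ⊨St-transfer φ 2t<low 2t<high ,
                    low-root⇒⊨Lin p (≤-reflexive low-value) , top-root⇒⊭Lin p

    Ct-separation : ∃₂ λ M N → (⊨Ct M φ → ⊨Ct N φ) × ⊨Lin M reachesNotP × ¬ ⊨Lin N reachesNotP
    Ct-separation = low , high , ⊨Ct-transfer φ 2t<low 2t<high ,
                    low-root⇒⊨Lin p (≤-reflexive low-value) , top-root⇒⊭Lin p

  ¬St≽Lin : ¬ (⊨St ≽ ⊨Lin)
  ¬St≽Lin = separated⇒¬≽ reachesNotP St-separation

  ¬Ct≽Lin : ¬ (⊨Ct ≽ ⊨Lin)
  ¬Ct≽Lin = separated⇒¬≽ reachesNotP Ct-separation

theorem43 : (n : ℕ) →
    Incomparable (⊨Lin {Fin (suc n)}) ⊨St × Incomparable (⊨Lin {Fin (suc n)}) ⊨Ct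
theorem43 n = (¬Lin≽St zero , ¬St≽Lin zero) , (¬Lin≽Ct zero , ¬Ct≽Lin zero)
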